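{- Let $V$ be a finite set of variables and $\mathcal C=\{C_1,\dots,C_m\}$ a set of $m$ betweenness constraints over $V$ that contains no complete triple. Let $\phi:V\to\{0,1,2,3\}$ be a uniformly random function and $X=w(\mathcal C,\phi)$. Then $\mathbb E[X^2]\ge \frac{11}{768}m$.
   Context: A betweenness constraint is written $(v_i,\{v_j,v_k\})$ for distinct $v_i,v_j,v_k\in V$, with variable set $vars((v_i,\{v_j,v_k\}))=\{v_i,v_j,v_k\}$; a bijection $\alpha:V\to\{1,\dots,|V|\}$ satisfies it if $\alpha(v_j)<\alpha(v_i)<\alpha(v_k)$ or $\alpha(v_k)<\alpha(v_i)<\alpha(v_j)$. A triple $A,B,C$ of distinct constraints of $\mathcal C$ is complete if $vars(A)=vars(B)=vars(C)$. For $\phi:V\to\{0,1,2,3\}$ let $\ell_i(\phi)=|\phi^{ -1}(i)|$. A random $\phi$-compatible bijection $\alpha$ is obtained by assigning the values $1,\dots,\ell_0(\phi)$ uniformly at random (bijectively) to the variables with $\phi(v)=0$, and, for $j=1,2,3$, the values $\sum_{i<j}\ell_i(\phi)+1,\dots,\sum_{i\le j}\ell_i(\phi)$ uniformly at random to the variables with $\phi(v)=j$. For a constraint $C_p$, let $\nu_p(\alpha)=1$ if $\alpha$ satisfies $C_p$ and $0$ otherwise; define $w(C_p,\phi)=\mathbb E[\nu_p(\alpha)]-1/3$, the expectation over a random $\phi$-compatible bijection $\alpha$ for fixed $\phi$, and $w(\mathcal C,\phi)=\sum_{p=1}^m w(C_p,\phi)$. A uniformly random $\phi$ assigns to each variable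 independently a uniformly random value in $\{0,1,2,3\}$. -}

module Defs where

open import Data.Nat using (ℕ; zero; suc)
open import Data.Fin using (Fin; toℕ) renaming (_<?_ to _<ᶠ?_; _≟_ to _≟ᶠ_)
open import Data.Vec using (Vec; []; _∷_; lookup)
open import Data.List using (List; []; _∷_; map; concatMap; allFin; filter; length; foldr)
open import Data.Bool using (Bool; true; false; _∧_; _∨_; not; if_then_else_)
open import Data.Product using (_×_; _,_; Σ)
open import Data.Integer using (+_)
open import Data.Rational using (ℚ; 0ℚ; 1ℚ; _+_; _-_; _*_; _/_)
open import Relation.Nullary.Decidable using (⌊_⌋)
open import Relation.Binary.PropositionalEquality using (_≡_)
open import Relation.Nullary using (¬_)

-- A betweenness constraint (v_i , {v_j , v_k}) is
-- represented by the triple (i , j , k); the triples (i , j , k) and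
-- (i , k , j) denote the same constraint (see SameConstraint).
Constraint : ℕ → Set
Constraint n = Fin n × Fin n × Fin n

WellFormed : ∀ {n} → Constraint n → Set
WellFormed (i , j , k) = ¬ i ≡ j × ¬ i ≡ k × ¬ j ≡ k

SameConstraint : ∀ {n} → Constraint n → Constraint n → Set
SameConstraint (i , j , k) (i' , j' , k') =
  i ≡ i' × ((j ≡ j' × k ≡ k') Data.Sum.⊎ (j ≡ k' × k ≡ j'))
  where import Data.Sum

InVars : ∀ {n} → Fin n → Constraint n → Set
InVars x (i , j , k) = (x ≡ i Data.Sum.⊎ x ≡ j) Data.Sum.⊎ x ≡ k
  where import Data.Sum

SameVars : ∀ {n} → Constraint n → Constraint n → Set
SameVars {n} c d = (∀ (x : Fin n) → InVars x c → InVars x d)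
                 × (∀ (x : Fin n) → InVars x d → InVars x c)

-- C : Fin m → Constraint n is a *set* {C_1,…,C_m} of m constraints
IsConstraintSet : ∀ {n m} → (Fin m → Constraint n) → Set
IsConstraintSet {n} {m} C =
  (∀ p → WellFormed (C p)) × (∀ p q → SameConstraint (C p) (C q) → p ≡ q)

HasCompleteTriple : ∀ {n m} → (Fin m → Constraint n) → Set
HasCompleteTriple {n} {m} C =
  Σ (Fin m) λ p → Σ (Fin m) λ q → Σ (Fin m) λ r →
    (¬ p ≡ q × ¬ p ≡ r × ¬ q ≡ r) × (SameVars (C p) (C q) × SameVars (C p) (C r))

allVec : (k n : ℕ) → List (Vec (Fin k) n)
allVec k zero = [] ∷ []
allVec k (suc n) = concatMap (λ x → map (x ∷_) (allVec k n)) (allFin k)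

-- average of a list of rationals (uniform distribution on the list); 0 for []
avg : List ℚ → ℚ
avg [] = 0ℚ
avg (x ∷ xs) = foldr _+_ 0ℚ (x ∷ xs) * ((+ 1) / suc (length xs))

sumℚ : List ℚ → ℚ
sumℚ = foldr _+_ 0ℚ

allB : ∀ {A : Set} → (A → Bool) → List A → Bool
allB f = foldr (λ x b → f x ∧ b) true

-- α : V → {1,…,n} represented (0-based) as α : Vec (Fin n) n; it is a bijection
-- iff it is injective
isBijection : ∀ {n} → Vec (Fin n) n → Bool
isBijection {n} α =
  allB (λ u → allB (λ v → ⌊ u ≟ᶠ v ⌋ ∨ not ⌊ lookup α u ≟ᶠ lookup α v ⌋) (allFin n)) (allFin n)

-- α is φ-compatible: the variables with φ = 0 receive the smallest values,
-- then those with φ = 1, etc.; i.e. φ(u) < φ(v) implies α(u) < α(v)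
isCompatible : ∀ {n} → Vec (Fin 4) n → Vec (Fin n) n → Bool
isCompatible {n} φ α =
  allB (λ u → allB (λ v → not ⌊ lookup φ u <ᶠ? lookup φ v ⌋ ∨ ⌊ lookup α u <ᶠ? lookup α v ⌋)
                 (allFin n)) (allFin n)

-- the φ-compatible bijections; a random φ-compatible bijection is uniform on this list
compatibleBijections : ∀ {n} → Vec (Fin 4) n → List (Vec (Fin n) n)
compatibleBijections {n} φ =
  Data.List.filter (λ α → Data.Bool.T? (isBijection α ∧ isCompatible φ α)) (allVec n n)
  where import Data.Bool

satisfies : ∀ {n} → Vec (Fin n) n → Constraint n → Bool
satisfies α (i , j , k) =
  (⌊ lookup α j <ᶠ? lookup α i ⌋ ∧ ⌊ lookup α i <ᶠ? lookup α k ⌋) ∨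
  (⌊ lookup α k <ᶠ? lookup α i ⌋ ∧ ⌊ lookup α i <ᶠ? lookup α j ⌋)

ν : ∀ {n} → Vec (Fin n) n → Constraint n → ℚ
ν α c = if satisfies α c then 1ℚ else 0ℚ

w : ∀ {n} → Constraint n → Vec (Fin 4) n → ℚ
w c φ = avg (map (λ α → ν α c) (compatibleBijections φ)) - ((+ 1) / 3)

wSet : ∀ {n m} → (Fin m → Constraint n) → Vec (Fin 4) n → ℚ
wSet {n} {m} C φ = sumℚ (map (λ p → w (C p) φ) (allFin m))

expectedSquare : ∀ {n m} → (Fin m → Constraint n) → ℚ
expectedSquare {n} C = avg (map (λ φ → wSet C φ * wSet C φ) (allVec 4 n))

module Submission where

-- Let Top : {0..3}³ → ℚ be the part of the satisfaction function W
-- of a single constraint that is orthogonal to every function of at most two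
-- of its arguments (its sums along each argument vanish), and let
-- Y(φ) = Σ_q Top(φ on the variables of C_q).  Since (X − Y)² ≥ 0,
--   Σ_φ X² ≥ Σ_φ (2X − Y)·Y = Σ_p Σ_q pairTerm(C_p, C_q).
-- (1) Closed form: w(C_p, φ) = W(φ i, φ j, φ k), proved by pairing up
--     compatible bijections with swaps of positions having equal φ-value.
-- (2) pairTerm(C_p, C_q) = 0 when C_q has a variable outside C_p, because Top
--     has zero sums along that variable.
-- (3) Otherwise pairTerm is |Φ| (the number of maps φ) times a correlation
--     of two fixed 4×4×4 tables, computed exactly: 11/384 for q = p and at
--     least −11/768 otherwise.
-- (4) Without complete triples at most one q ≠ p shares the variables of C_p,
--     so every row Σ_q pairTerm(C_p, C_q) is at least |Φ|·11/768.
-- The file develops finite sums, sums over all vectors, betweenness, the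
-- compatible bijections and the closed form (1), the tables, the pair terms
-- (2)–(3), and finally the counting (4) and the theorem.

open import Defs
open import Data.Nat as ℕ using (ℕ; zero; suc)
import Data.Nat.Properties as ℕP
open import Data.Nat.Solver renaming (module +-*-Solver to ℕ-Solver)
open import Data.Fin as F using (Fin; zero; suc; toℕ; fromℕ<) renaming (_<?_ to _<ᶠ?_; _≟_ to _≟ᶠ_)
import Data.Fin.Properties as FP
open import Data.Fin.Patterns using (0F; 1F; 2F)
open import Data.Fin.Permutation.Components using (transpose)
open import Data.Vec as V using (Vec; []; _∷_; lookup; tabulate; _[_]≔_)
import Data.Vec.Properties as VP
open import Data.List using (List; []; _∷_; map; concatMap; allFin; filter; length; _++_)
import Data.List.Properties as LP
open import Data.List.Membership.Propositional using (_∈_; lose)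
import Data.List.Membership.Propositional.Properties as MP
open import Data.List.Relation.Unary.Any using (here; there)
open import Data.Bool using (Bool; true; false; _∧_; _∨_; not; if_then_else_; T; T?)
import Data.Bool.Properties as BP
open import Data.Integer as Int using (ℤ; +_)
open import Data.Integer.Solver renaming (module +-*-Solver to ℤ-Solver)
open import Data.Rational as Q using (ℚ; toℚᵘ; 0ℚ; 1ℚ; _+_; _-_; _*_; _/_; _≤_; _<_)
import Data.Rational.Properties as QP
open import Data.Rational.Solver using (module +-*-Solver)
import Data.Rational.Unnormalised as U
import Data.Rational.Unnormalised.Properties as UP
open import Data.Product using (Σ; _×_; _,_; proj₁; proj₂)
open import Data.Sum using (_⊎_; inj₁; inj₂; [_,_]′)
open import Data.Empty using (⊥-elim)
open import Data.Unit using (tt)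
open import Function using (_∘_; id; Equivalence)
open import Relation.Nullary using (¬_; ¬?; Dec; yes; no; contradiction)
open import Relation.Nullary.Decidable
  using (⌊_⌋; dec-true; dec-false; toWitness; toWitnessFalse; fromWitness; fromWitnessFalse; _→-dec_; _⊎-dec_; _×-dec_)
open import Relation.Binary.Definitions using (tri<; tri≈; tri>)
open import Relation.Binary.PropositionalEquality hiding ([_])

-- Finite sums of rationals.

cong₃ : {A B C D : Set} (f : A → B → C → D) {a a′ : A} {b b′ : B} {c c′ : C} →
        a ≡ a′ → b ≡ b′ → c ≡ c′ → f a b c ≡ f a′ b′ c′
cong₃ f refl refl refl = refl

sumOver : {A : Set} → List A → (A → ℚ) → ℚ
sumOver xs f = sumℚ (map f xs)

syntax sumOver xs (λ x → e) = ∑[ x ← xs ] e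

-- The natural number k as a rational, by repeated addition of 1 so that sums
-- of constants can be computed by induction.
ℕtoℚ : ℕ → ℚ
ℕtoℚ zero    = 0ℚ
ℕtoℚ (suc k) = 1ℚ + ℕtoℚ k

ℕtoℚ-nonneg : ∀ k → 0ℚ ≤ ℕtoℚ k
ℕtoℚ-nonneg zero    = QP.≤-refl
ℕtoℚ-nonneg (suc k) = QP.+-mono-≤ (QP.<⇒≤ (QP.positive⁻¹ 1ℚ)) (ℕtoℚ-nonneg k)

ℕtoℚ-pos : ∀ k → 0ℚ < ℕtoℚ (suc k)
ℕtoℚ-pos k = QP.+-mono-<-≤ (QP.positive⁻¹ 1ℚ) (ℕtoℚ-nonneg k)

ℕtoℚ-fraction : ∀ k → ℕtoℚ k ≡ (+ k) / 1
ℕtoℚ-fraction zero    = refl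
ℕtoℚ-fraction (suc k) rewrite ℕtoℚ-fraction k = QP.toℚᵘ-injective (begin
    toℚᵘ (1ℚ + (+ k) / 1)
  ≈⟨ QP.toℚᵘ-homo-+ 1ℚ ((+ k) / 1) ⟩
    U.mkℚᵘ (+ 1) 0 U.+ toℚᵘ ((+ k) / 1)
  ≈⟨ UP.+-congʳ (U.mkℚᵘ (+ 1) 0) (QP.toℚᵘ-fromℚᵘ (U.mkℚᵘ (+ k) 0)) ⟩
    U.mkℚᵘ (+ 1) 0 U.+ U.mkℚᵘ (+ k) 0
  ≈⟨ U.*≡* (cross-multiplied (+ k)) ⟩
    U.mkℚᵘ (+ suc k) 0
  ≈⟨ UP.≃-sym (QP.toℚᵘ-fromℚᵘ (U.mkℚᵘ (+ suc k) 0)) ⟩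
    toℚᵘ ((+ suc k) / 1) ∎)
  where
  open UP.≃-Reasoning
  open ℤ-Solver
  cross-multiplied : ∀ x → (+ 1 Int.* + 1 Int.+ x Int.* + 1) Int.* + 1 ≡ (+ 1 Int.+ x) Int.* (+ 1 Int.* + 1)
  cross-multiplied = solve 1 (λ x → (con (+ 1) :* con (+ 1) :+ x :* con (+ 1)) :* con (+ 1)
                                  := (con (+ 1) :+ x) :* (con (+ 1) :* con (+ 1))) refl

inverse-suc : ∀ k → ((+ 1) / suc k) * ℕtoℚ (suc k) ≡ 1ℚ
inverse-suc k rewrite ℕtoℚ-fraction (suc k) = QP.toℚᵘ-injective (begin
    toℚᵘ ((+ 1) / suc k * ((+ suc k) / 1))
  ≈⟨ QP.toℚᵘ-homo-* ((+ 1) / suc k) ((+ suc k) / 1) ⟩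
    toℚᵘ ((+ 1) / suc k) U.* toℚᵘ ((+ suc k) / 1)
  ≈⟨ UP.*-cong (QP.toℚᵘ-fromℚᵘ (U.mkℚᵘ (+ 1) k)) (QP.toℚᵘ-fromℚᵘ (U.mkℚᵘ (+ suc k) 0)) ⟩
    U.mkℚᵘ (+ 1) k U.* U.mkℚᵘ (+ suc k) 0
  ≈⟨ U.*≡* (cong +_ (cross-multiplied k)) ⟩
    toℚᵘ 1ℚ ∎)
  where
  open UP.≃-Reasoning
  open ℕ-Solver
  cross-multiplied : ∀ k → (1 ℕ.* suc k) ℕ.* 1 ≡ 1 ℕ.* (suc k ℕ.* 1)
  cross-multiplied = solve 1 (λ k → (con 1 :* (con 1 :+ k)) :* con 1 := con 1 :* ((con 1 :+ k) :* con 1)) refl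

*-cancelˡ-pos : ∀ (a b c : ℚ) → 0ℚ < c → c * a ≡ c * b → a ≡ b
*-cancelˡ-pos a b c c>0 eq = QP.≤-antisym
  (QP.*-cancelˡ-≤-pos c {{Q.positive c>0}} (QP.≤-reflexive eq))
  (QP.*-cancelˡ-≤-pos c {{Q.positive c>0}} (QP.≤-reflexive (sym eq)))

module _ {A : Set} where

  sum-cong : (xs : List A) {f g : A → ℚ} → (∀ x → f x ≡ g x) → sumOver xs f ≡ sumOver xs g
  sum-cong []       f≡g = refl
  sum-cong (x ∷ xs) f≡g = cong₂ _+_ (f≡g x) (sum-cong xs f≡g)

  sum-cong-∈ : (xs : List A) {f g : A → ℚ} → (∀ {x} → x ∈ xs → f x ≡ g x) →
               sumOver xs f ≡ sumOver xs g
  sum-cong-∈ []       f≡g = refl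
  sum-cong-∈ (x ∷ xs) f≡g = cong₂ _+_ (f≡g (here refl)) (sum-cong-∈ xs (f≡g ∘ there))

  sum-zero : (xs : List A) → (∑[ x ← xs ] 0ℚ) ≡ 0ℚ
  sum-zero []       = refl
  sum-zero (x ∷ xs) = trans (cong (λ s → 0ℚ + s) (sum-zero xs)) (QP.+-identityˡ 0ℚ)

  sum-+ : (xs : List A) (f g : A → ℚ) →
          (∑[ x ← xs ] (f x + g x)) ≡ sumOver xs f + sumOver xs g
  sum-+ []       f g = refl
  sum-+ (x ∷ xs) f g rewrite sum-+ xs f g = interchange (f x) (g x) (sumOver xs f) (sumOver xs g)
    where
    open +-*-Solver
    interchange : ∀ a b c d → (a + b) + (c + d) ≡ (a + c) + (b + d)
    interchange = solve 4 (λ a b c d → (a :+ b) :+ (c :+ d) := (a :+ c) :+ (b :+ d)) refl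

  sum-*ˡ : (xs : List A) (c : ℚ) (f : A → ℚ) → (∑[ x ← xs ] (c * f x)) ≡ c * sumOver xs f
  sum-*ˡ []       c f = sym (QP.*-zeroʳ c)
  sum-*ˡ (x ∷ xs) c f rewrite sum-*ˡ xs c f = sym (QP.*-distribˡ-+ c (f x) (sumOver xs f))

  sum-neg : (xs : List A) (f : A → ℚ) → (∑[ x ← xs ] (Q.- f x)) ≡ Q.- sumOver xs f
  sum-neg []       f = refl
  sum-neg (x ∷ xs) f rewrite sum-neg xs f = sym (QP.neg-distrib-+ (f x) (sumOver xs f))

  sum-- : (xs : List A) (f g : A → ℚ) →
          (∑[ x ← xs ] (f x - g x)) ≡ sumOver xs f - sumOver xs g
  sum-- xs f g = trans (sum-+ xs f (λ x → Q.- g x)) (cong (λ s → sumOver xs f + s) (sum-neg xs g))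

  sum-const : (xs : List A) (c : ℚ) → (∑[ x ← xs ] c) ≡ ℕtoℚ (length xs) * c
  sum-const []       c = sym (QP.*-zeroˡ c)
  sum-const (x ∷ xs) c = begin
    c + sumOver xs (λ _ → c)         ≡⟨ cong₂ _+_ (sym (QP.*-identityˡ c)) (sum-const xs c) ⟩
    1ℚ * c + ℕtoℚ (length xs) * c    ≡⟨ sym (QP.*-distribʳ-+ c 1ℚ (ℕtoℚ (length xs))) ⟩
    ℕtoℚ (suc (length xs)) * c       ∎
    where open ≡-Reasoning

  sum-mono : (xs : List A) {f g : A → ℚ} → (∀ x → f x ≤ g x) → sumOver xs f ≤ sumOver xs g
  sum-mono []       f≤g = QP.≤-refl
  sum-mono (x ∷ xs) f≤g = QP.+-mono-≤ (f≤g x) (sum-mono xs f≤g)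

  sum-nonneg : (xs : List A) (f : A → ℚ) → (∀ x → 0ℚ ≤ f x) → 0ℚ ≤ sumOver xs f
  sum-nonneg xs f f≥0 = subst (_≤ sumOver xs f) (sum-zero xs) (sum-mono xs f≥0)

  sum-++ : (xs ys : List A) (f : A → ℚ) → sumOver (xs ++ ys) f ≡ sumOver xs f + sumOver ys f
  sum-++ []       ys f = sym (QP.+-identityˡ _)
  sum-++ (x ∷ xs) ys f rewrite sum-++ xs ys f = sym (QP.+-assoc (f x) (sumOver xs f) (sumOver ys f))

module _ {A B : Set} where

  sum-map : (xs : List A) (g : A → B) (f : B → ℚ) → sumOver (map g xs) f ≡ sumOver xs (f ∘ g)
  sum-map []       g f = refl
  sum-map (x ∷ xs) g f = cong (λ s → f (g x) + s) (sum-map xs g f)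

  sum-concatMap : (xs : List A) (h : A → List B) (f : B → ℚ) →
                  sumOver (concatMap h xs) f ≡ (∑[ x ← xs ] sumOver (h x) f)
  sum-concatMap []       h f = refl
  sum-concatMap (x ∷ xs) h f =
    trans (sum-++ (h x) (concatMap h xs) f) (cong (λ s → sumOver (h x) f + s) (sum-concatMap xs h f))

  sum-swap : (xs : List A) (ys : List B) (f : A → B → ℚ) →
             (∑[ x ← xs ] ∑[ y ← ys ] f x y) ≡ (∑[ y ← ys ] ∑[ x ← xs ] f x y)
  sum-swap []       ys f = sym (sum-zero ys)
  sum-swap (x ∷ xs) ys f rewrite sum-swap xs ys f = sym (sum-+ ys (f x) (λ y → sumOver xs (λ x → f x y)))

  sum-product : (xs : List A) (ys : List B) (f : A → ℚ) (g : B → ℚ) →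
                sumOver xs f * sumOver ys g ≡ (∑[ x ← xs ] ∑[ y ← ys ] (f x * g y))
  sum-product xs ys f g = begin
    sumOver xs f * sumOver ys g              ≡⟨ QP.*-comm (sumOver xs f) _ ⟩
    sumOver ys g * sumOver xs f              ≡⟨ sym (sum-*ˡ xs (sumOver ys g) f) ⟩
    (∑[ x ← xs ] (sumOver ys g * f x))       ≡⟨ sum-cong xs (λ x → QP.*-comm (sumOver ys g) (f x)) ⟩
    (∑[ x ← xs ] (f x * sumOver ys g))       ≡⟨ sum-cong xs (λ x → sym (sum-*ˡ ys (f x) g)) ⟩
    (∑[ x ← xs ] ∑[ y ← ys ] (f x * g y))    ∎
    where open ≡-Reasoning

sum-filter : {A : Set} (p : A → Bool) (xs : List A) (f : A → ℚ) →
             sumOver (filter (λ x → T? (p x)) xs) f ≡ (∑[ x ← xs ] (if p x then f x else 0ℚ))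
sum-filter p []       f = refl
sum-filter p (x ∷ xs) f with p x
... | true  = cong (λ s → f x + s) (sum-filter p xs f)
... | false = trans (sum-filter p xs f) (sym (QP.+-identityˡ _))

avg-map : {A : Set} (xs : List A) (f : A → ℚ) {y : A} → y ∈ xs →
          avg (map f xs) * ℕtoℚ (length xs) ≡ sumOver xs f
avg-map (x ∷ xs) f _ rewrite LP.length-map f xs = begin
    sumOver (x ∷ xs) f * ((+ 1) / suc (length xs)) * ℕtoℚ (suc (length xs))
  ≡⟨ QP.*-assoc (sumOver (x ∷ xs) f) _ _ ⟩
    sumOver (x ∷ xs) f * (((+ 1) / suc (length xs)) * ℕtoℚ (suc (length xs)))
  ≡⟨ cong (sumOver (x ∷ xs) f *_) (inverse-suc (length xs)) ⟩
    sumOver (x ∷ xs) f * 1ℚ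
  ≡⟨ QP.*-identityʳ _ ⟩
    sumOver (x ∷ xs) f ∎
  where open ≡-Reasoning

length-pos : {A : Set} {xs : List A} {y : A} → y ∈ xs → 0ℚ < ℕtoℚ (length xs)
length-pos {xs = x ∷ xs} _ = ℕtoℚ-pos (length xs)

average-as-ratio : {A : Set} (xs : List A) (f : A → ℚ) (r : ℚ) {y : A} → y ∈ xs →
                   sumOver xs f ≡ r * ℕtoℚ (length xs) → avg (map f xs) ≡ r
average-as-ratio xs f r y∈xs sum≡ = *-cancelˡ-pos _ _ (ℕtoℚ (length xs)) (length-pos y∈xs)
  (trans (QP.*-comm (ℕtoℚ (length xs)) _) (trans (avg-map xs f y∈xs) (trans sum≡ (QP.*-comm r _))))

sum-allFin-const : (k : ℕ) (c : ℚ) → (∑[ a ← allFin k ] c) ≡ ℕtoℚ k * c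
sum-allFin-const k c = trans (sum-const (allFin k) c) (cong (λ l → ℕtoℚ l * c) (LP.length-tabulate {n = k} id))

sum-allFin-suc : (m : ℕ) (f : Fin (suc m) → ℚ) →
                 sumOver (allFin (suc m)) f ≡ f zero + sumOver (allFin m) (f ∘ suc)
sum-allFin-suc m f =
  cong (λ xs → f zero + sumℚ xs) (trans (LP.map-tabulate suc f) (sym (LP.map-tabulate id (f ∘ suc))))

sum-split : (m : ℕ) (p : Fin m) (f : Fin m → ℚ) →
            sumOver (allFin m) f ≡ f p + (∑[ q ← allFin m ] (if ⌊ q ≟ᶠ p ⌋ then 0ℚ else f q))
sum-split (suc m) zero f = begin
    sumOver (allFin (suc m)) f
  ≡⟨ sum-allFin-suc m f ⟩
    f zero + sumOver (allFin m) (f ∘ suc)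
  ≡⟨ cong (λ s → f zero + s) (sym (QP.+-identityˡ _)) ⟩
    f zero + (0ℚ + sumOver (allFin m) (f ∘ suc))
  ≡⟨ cong (λ s → f zero + s) (sym (sum-allFin-suc m rest)) ⟩
    f zero + sumOver (allFin (suc m)) rest ∎
  where
  open ≡-Reasoning
  rest : Fin (suc m) → ℚ
  rest q = if ⌊ q ≟ᶠ zero ⌋ then 0ℚ else f q
sum-split (suc m) (suc p) f = begin
    sumOver (allFin (suc m)) f
  ≡⟨ sum-allFin-suc m f ⟩
    f zero + sumOver (allFin m) (f ∘ suc)
  ≡⟨ cong (λ s → f zero + s) (sum-split m p (f ∘ suc)) ⟩
    f zero + (f (suc p) + (∑[ q ← allFin m ] (if ⌊ q ≟ᶠ p ⌋ then 0ℚ else f (suc q))))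
  ≡⟨ cong (λ s → f zero + (f (suc p) + s)) (sum-cong (allFin m) shift) ⟩
    f zero + (f (suc p) + sumOver (allFin m) (rest ∘ suc))
  ≡⟨ exchange (f zero) (f (suc p)) _ ⟩
    f (suc p) + (f zero + sumOver (allFin m) (rest ∘ suc))
  ≡⟨ cong (λ s → f (suc p) + s) (sym (sum-allFin-suc m rest)) ⟩
    f (suc p) + sumOver (allFin (suc m)) rest ∎
  where
  open ≡-Reasoning
  rest : Fin (suc m) → ℚ
  rest q = if ⌊ q ≟ᶠ suc p ⌋ then 0ℚ else f q
  shift : ∀ q → (if ⌊ q ≟ᶠ p ⌋ then 0ℚ else f (suc q)) ≡ rest (suc q)
  shift q with q ≟ᶠ p
  ... | yes refl = refl
  ... | no q≢p   = refl
  exchange : ∀ a b c → a + (b + c) ≡ b + (a + c)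
  exchange = solve 3 (λ a b c → a :+ (b :+ c) := b :+ (a :+ c)) refl
    where open +-*-Solver

sum-one-exception : (m : ℕ) (f : Fin m → ℚ) (c : ℚ) (P : Fin m → Set) → c ≤ 0ℚ →
                    (∀ q → 0ℚ ≤ f q ⊎ (P q × c ≤ f q)) → (∀ q q′ → P q → P q′ → q ≡ q′) →
                    c ≤ sumOver (allFin m) f
sum-one-exception zero    f c P c≤0 terms unique = c≤0
sum-one-exception (suc m) f c P c≤0 terms unique with terms zero
... | inj₁ 0≤f0 = subst₂ _≤_ (QP.+-identityˡ c) (sym (sum-allFin-suc m f))
  (QP.+-mono-≤ 0≤f0 (sum-one-exception m (f ∘ suc) c (P ∘ suc) c≤0 (terms ∘ suc)
                      (λ q q′ Pq Pq′ → FP.suc-injective (unique (suc q) (suc q′) Pq Pq′))))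
... | inj₂ (P0 , c≤f0) = subst₂ _≤_ (QP.+-identityʳ c) (sym (sum-allFin-suc m f))
  (QP.+-mono-≤ c≤f0 (sum-nonneg (allFin m) (f ∘ suc) rest-nonneg))
  where
  rest-nonneg : ∀ q → 0ℚ ≤ f (suc q)
  rest-nonneg q with terms (suc q)
  ... | inj₁ 0≤f = 0≤f
  ... | inj₂ (Pq , _) with () ← unique zero (suc q) P0 Pq

-- (2x − y)·y ≤ x², since the difference is (x − y)²: the pointwise form of
-- E[X²] ≥ E[(2X − Y)·Y].
square-completion : ∀ x y → ((+ 2) / 1 * x - y) * y ≤ x * x
square-completion x y = subst₂ _≤_ (QP.+-identityʳ _) (sym (completed x y))
  (QP.+-monoʳ-≤ (((+ 2) / 1 * x - y) * y) (square-nonneg (x - y)))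
  where
  square-nonneg : ∀ z → 0ℚ ≤ z * z
  square-nonneg z with QP.≤-total 0ℚ z
  ... | inj₁ 0≤z = QP.nonNegative⁻¹ _ {{QP.nonNeg*nonNeg⇒nonNeg z {{Q.nonNegative 0≤z}} z {{Q.nonNegative 0≤z}}}}
  ... | inj₂ z≤0 = QP.nonNegative⁻¹ _ {{QP.nonPos*nonPos⇒nonPos z {{Q.nonPositive z≤0}} z {{Q.nonPositive z≤0}}}}
  completed : ∀ x y → x * x ≡ ((+ 2) / 1 * x - y) * y + (x - y) * (x - y)
  completed = solve 2 (λ x y → x :* x := (con ((+ 2) / 1) :* x :- y) :* y :+ (x :- y) :* (x :- y)) refl
    where open +-*-Solver

vec-ext : {A : Set} {n : ℕ} (v w : Vec A n) → (∀ u → lookup v u ≡ lookup w u) → v ≡ w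
vec-ext v w v≗w = trans (sym (VP.tabulate∘lookup v)) (trans (VP.tabulate-cong v≗w) (VP.tabulate∘lookup w))

∈-allVec : (k n : ℕ) (v : Vec (Fin k) n) → v ∈ allVec k n
∈-allVec k zero    []      = here refl
∈-allVec k (suc n) (a ∷ v) =
  MP.∈-concatMap⁺ (λ b → map (b ∷_) (allVec k n)) (lose (MP.∈-allFin a) (MP.∈-map⁺ (a ∷_) (∈-allVec k n v)))

allVec-empty : {n : ℕ} → Fin n → allVec 0 n ≡ []
allVec-empty zero    = refl
allVec-empty (suc _) = refl

sum-allVec-suc : (k n : ℕ) (F : Vec (Fin k) (suc n) → ℚ) →
                 sumOver (allVec k (suc n)) F ≡ (∑[ a ← allFin k ] ∑[ r ← allVec k n ] F (a ∷ r))
sum-allVec-suc k n F = trans (sum-concatMap (allFin k) (λ a → map (a ∷_) (allVec k n)) F)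
                             (sum-cong (allFin k) (λ a → sum-map (allVec k n) (a ∷_) F))

-- Resampling one coordinate: replacing the t-th value of φ by every
-- a ∈ Fin k and summing over φ counts every vector exactly k times.
integrate : (k n : ℕ) (t : Fin n) (F : Vec (Fin k) n → ℚ) →
            (∑[ φ ← allVec k n ] ∑[ a ← allFin k ] F (φ [ t ]≔ a)) ≡ ℕtoℚ k * sumOver (allVec k n) F
integrate k (suc n) zero F = begin
    (∑[ φ ← allVec k (suc n) ] ∑[ a ← allFin k ] F (φ [ zero ]≔ a))
  ≡⟨ sum-allVec-suc k n _ ⟩
    (∑[ b ← allFin k ] ∑[ r ← allVec k n ] ∑[ a ← allFin k ] F (a ∷ r))
  ≡⟨ sum-allFin-const k _ ⟩
    ℕtoℚ k * (∑[ r ← allVec k n ] ∑[ a ← allFin k ] F (a ∷ r))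
  ≡⟨ cong (ℕtoℚ k *_) (sum-swap (allVec k n) (allFin k) (λ r a → F (a ∷ r))) ⟩
    ℕtoℚ k * (∑[ a ← allFin k ] ∑[ r ← allVec k n ] F (a ∷ r))
  ≡⟨ cong (ℕtoℚ k *_) (sym (sum-allVec-suc k n F)) ⟩
    ℕtoℚ k * sumOver (allVec k (suc n)) F ∎
  where open ≡-Reasoning
integrate k (suc n) (suc t) F = begin
    (∑[ φ ← allVec k (suc n) ] ∑[ a ← allFin k ] F (φ [ suc t ]≔ a))
  ≡⟨ sum-allVec-suc k n _ ⟩
    (∑[ b ← allFin k ] ∑[ r ← allVec k n ] ∑[ a ← allFin k ] F (b ∷ (r [ t ]≔ a)))
  ≡⟨ sum-cong (allFin k) (λ b → integrate k n t (λ r → F (b ∷ r))) ⟩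
    (∑[ b ← allFin k ] (ℕtoℚ k * sumOver (allVec k n) (λ r → F (b ∷ r))))
  ≡⟨ sum-*ˡ (allFin k) (ℕtoℚ k) _ ⟩
    ℕtoℚ k * (∑[ b ← allFin k ] ∑[ r ← allVec k n ] F (b ∷ r))
  ≡⟨ cong (ℕtoℚ k *_) (sym (sum-allVec-suc k n F)) ⟩
    ℕtoℚ k * sumOver (allVec k (suc n)) F ∎
  where open ≡-Reasoning

-- If H ignores coordinate t and G sums to zero along coordinate t, then
-- Σ_φ H·G = 0: resample coordinate t and factor H out of the inner sum.
orthogonal : (k n : ℕ) (t : Fin n) (H G : Vec (Fin (suc k)) n → ℚ) →
             (∀ φ a → H (φ [ t ]≔ a) ≡ H φ) →
             (∀ φ → (∑[ a ← allFin (suc k) ] G (φ [ t ]≔ a)) ≡ 0ℚ) →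
             (∑[ φ ← allVec (suc k) n ] (H φ * G φ)) ≡ 0ℚ
orthogonal k n t H G H-ignores-t G-balanced =
  *-cancelˡ-pos _ _ (ℕtoℚ (suc k)) (ℕtoℚ-pos k) (begin
    ℕtoℚ (suc k) * (∑[ φ ← Φ ] (H φ * G φ))
  ≡⟨ sym (integrate (suc k) n t (λ φ → H φ * G φ)) ⟩
    (∑[ φ ← Φ ] ∑[ a ← allFin (suc k) ] (H (φ [ t ]≔ a) * G (φ [ t ]≔ a)))
  ≡⟨ sum-cong Φ (λ φ → sum-cong (allFin (suc k)) (λ a → cong (_* G (φ [ t ]≔ a)) (H-ignores-t φ a))) ⟩
    (∑[ φ ← Φ ] ∑[ a ← allFin (suc k) ] (H φ * G (φ [ t ]≔ a)))
  ≡⟨ sum-cong Φ (λ φ → trans (sum-*ˡ (allFin (suc k)) (H φ) _) (cong (H φ *_) (G-balanced φ))) ⟩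
    (∑[ φ ← Φ ] (H φ * 0ℚ))
  ≡⟨ sum-cong Φ (λ φ → QP.*-zeroʳ (H φ)) ⟩
    (∑[ φ ← Φ ] 0ℚ)
  ≡⟨ sum-zero Φ ⟩
    0ℚ
  ≡⟨ sym (QP.*-zeroʳ (ℕtoℚ (suc k))) ⟩
    ℕtoℚ (suc k) * 0ℚ ∎)
  where
  open ≡-Reasoning
  Φ : List (Vec (Fin (suc k)) n)
  Φ = allVec (suc k) n

sum³ : {k : ℕ} → (Fin k → Fin k → Fin k → ℚ) → ℚ
sum³ {k} g = ∑[ c ← allFin k ] ∑[ b ← allFin k ] ∑[ a ← allFin k ] g a b c

-- For distinct coordinates x, y, z the values (φ x, φ y, φ z) of a
-- uniformly random φ are independent and uniform: summing g over all φ is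
-- |Φ| / k³ times the sum of g over all value triples (resample x, y and z).
sum-three-coordinates : (k n : ℕ) (x y z : Fin n) → x ≢ y → x ≢ z → y ≢ z →
  (g : Fin k → Fin k → Fin k → ℚ) →
  ℕtoℚ k * (ℕtoℚ k * (ℕtoℚ k * (∑[ φ ← allVec k n ] g (lookup φ x) (lookup φ y) (lookup φ z))))
    ≡ ℕtoℚ (length (allVec k n)) * sum³ g
sum-three-coordinates k n x y z x≢y x≢z y≢z g = begin
    ℕtoℚ k * (ℕtoℚ k * (ℕtoℚ k * sumOver Φ G))
  ≡⟨ cong (λ s → ℕtoℚ k * (ℕtoℚ k * s)) (sym (integrate k n x G)) ⟩
    ℕtoℚ k * (ℕtoℚ k * sumOver Φ G₁)
  ≡⟨ cong (ℕtoℚ k *_) (sym (integrate k n y G₁)) ⟩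
    ℕtoℚ k * sumOver Φ G₂
  ≡⟨ sym (integrate k n z G₂) ⟩
    sumOver Φ G₃
  ≡⟨ sum-cong Φ G₃-const ⟩
    (∑[ φ ← Φ ] sum³ g)
  ≡⟨ sum-const Φ (sum³ g) ⟩
    ℕtoℚ (length Φ) * sum³ g ∎
  where
  open ≡-Reasoning
  Φ : List (Vec (Fin k) n)
  Φ = allVec k n
  G G₁ G₂ G₃ : Vec (Fin k) n → ℚ
  G φ  = g (lookup φ x) (lookup φ y) (lookup φ z)
  G₁ φ = ∑[ a ← allFin k ] G (φ [ x ]≔ a)
  G₂ φ = ∑[ b ← allFin k ] G₁ (φ [ y ]≔ b)
  G₃ φ = ∑[ c ← allFin k ] G₂ (φ [ z ]≔ c)
  -- after resampling x, y and z, the original values of φ are forgotten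
  G₃-const : ∀ φ → G₃ φ ≡ sum³ g
  G₃-const φ = sum-cong (allFin k) λ c → sum-cong (allFin k) λ b → sum-cong (allFin k) λ a →
    let φ₁ = φ [ z ]≔ c ; φ₂ = φ₁ [ y ]≔ b in
    cong₃ g (VP.lookup∘update x φ₂ a)
            (trans (VP.lookup∘update′ (x≢y ∘ sym) φ₂ a) (VP.lookup∘update y φ₁ b))
            (trans (VP.lookup∘update′ (x≢z ∘ sym) φ₂ a)
              (trans (VP.lookup∘update′ (y≢z ∘ sym) φ₁ b) (VP.lookup∘update z φ c)))

-- Betweenness of values in Fin k, and the shape of a triple of values.

ind : Bool → ℚ
ind b = if b then 1ℚ else 0ℚ

module _ {k : ℕ} where

  -- x lies strictly between y and z; satisfies α (i , j , k) is literally
  -- between (α i) (α j) (α k).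
  between : Fin k → Fin k → Fin k → Bool
  between x y z = (⌊ y <ᶠ? x ⌋ ∧ ⌊ x <ᶠ? z ⌋) ∨ (⌊ z <ᶠ? x ⌋ ∧ ⌊ x <ᶠ? y ⌋)

  private
    lt-true : {a b : Fin k} → a F.< b → ⌊ a <ᶠ? b ⌋ ≡ true
    lt-true {a} {b} a<b with a <ᶠ? b
    ... | yes _   = refl
    ... | no a≮b = contradiction a<b a≮b

    lt-false : {a b : Fin k} → ¬ a F.< b → ⌊ a <ᶠ? b ⌋ ≡ false
    lt-false {a} {b} a≮b with a <ᶠ? b
    ... | yes a<b = contradiction a<b a≮b
    ... | no _    = refl

  between-inside₁ : {x y z : Fin k} → y F.< x → x F.< z → between x y z ≡ true
  between-inside₁ y<x x<z rewrite lt-true y<x | lt-true x<z = refl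

  between-inside₂ : {x y z : Fin k} → z F.< x → x F.< y → between x y z ≡ true
  between-inside₂ z<x x<y rewrite lt-true z<x | lt-true x<y | lt-false (FP.<-asym x<y) = refl

  between-below : {x y z : Fin k} → x F.< y → x F.< z → between x y z ≡ false
  between-below x<y x<z rewrite lt-false (FP.<-asym x<y) | lt-false (FP.<-asym x<z) = refl

  between-above : {x y z : Fin k} → y F.< x → z F.< x → between x y z ≡ false
  between-above y<x z<x
    rewrite lt-true y<x | lt-true z<x | lt-false (FP.<-asym y<x) | lt-false (FP.<-asym z<x) = refl

  between-sym : (x y z : Fin k) → between x y z ≡ between x z y
  between-sym x y z = BP.∨-comm (⌊ y <ᶠ? x ⌋ ∧ ⌊ x <ᶠ? z ⌋) (⌊ z <ᶠ? x ⌋ ∧ ⌊ x <ᶠ? y ⌋)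

  between-tie : (x y z : Fin k) → x ≢ y → (x F.< z × y F.< z) ⊎ (z F.< x × z F.< y) →
                ind (between x y z) + ind (between y x z) ≡ 1ℚ
  between-tie x y z x≢y side with FP.<-cmp x y | side
  ... | tri≈ _ x≡y _ | _ = contradiction x≡y x≢y
  ... | tri< x<y _ _ | inj₁ (x<z , y<z) rewrite between-below x<y x<z | between-inside₁ x<y y<z = refl
  ... | tri< x<y _ _ | inj₂ (z<x , z<y) rewrite between-inside₂ z<x x<y | between-above x<y z<y = refl
  ... | tri> _ _ y<x | inj₁ (x<z , y<z) rewrite between-inside₁ y<x x<z | between-below y<x y<z = refl
  ... | tri> _ _ y<x | inj₂ (z<x , z<y) rewrite between-above y<x z<x | between-inside₂ z<y y<x = refl

  between-three : (x y z : Fin k) → x ≢ y → x ≢ z → y ≢ z →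
                  ind (between x y z) + ind (between y x z) + ind (between z y x) ≡ 1ℚ
  between-three x y z x≢y x≢z y≢z with FP.<-cmp x y | FP.<-cmp y z | FP.<-cmp x z
  ... | tri≈ _ x≡y _ | _ | _ = contradiction x≡y x≢y
  ... | _ | tri≈ _ y≡z _ | _ = contradiction y≡z y≢z
  ... | _ | _ | tri≈ _ x≡z _ = contradiction x≡z x≢z
  ... | tri< x<y _ _ | tri< y<z _ _ | tri< x<z _ _
    rewrite between-below x<y x<z | between-inside₁ x<y y<z | between-above y<z x<z = refl
  ... | tri< x<y _ _ | tri< y<z _ _ | tri> _ _ z<x = contradiction (FP.<-trans x<y y<z) (FP.<-asym z<x)
  ... | tri< x<y _ _ | tri> _ _ z<y | tri< x<z _ _
    rewrite between-below x<y x<z | between-above x<y z<y | between-inside₂ x<z z<y = refl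
  ... | tri< x<y _ _ | tri> _ _ z<y | tri> _ _ z<x
    rewrite between-inside₂ z<x x<y | between-above x<y z<y | between-below z<y z<x = refl
  ... | tri> _ _ y<x | tri< y<z _ _ | tri< x<z _ _
    rewrite between-inside₁ y<x x<z | between-below y<x y<z | between-above y<z x<z = refl
  ... | tri> _ _ y<x | tri< y<z _ _ | tri> _ _ z<x
    rewrite between-above y<x z<x | between-below y<x y<z | between-inside₁ y<z z<x = refl
  ... | tri> _ _ y<x | tri> _ _ z<y | tri< x<z _ _ = contradiction (FP.<-trans z<y y<x) (FP.<-asym x<z)
  ... | tri> _ _ y<x | tri> _ _ z<y | tri> _ _ z<x
    rewrite between-above y<x z<x | between-inside₂ z<y y<x | between-below z<y z<x = refl

  -- Position of the value a relative to b and c.  For a = φ i, b = φ j,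
  -- c = φ k it determines how a random φ-compatible bijection orders i, j, k.
  data Shape (a b c : Fin k) : Set where
    inside₁ : b F.< a → a F.< c → Shape a b c
    inside₂ : c F.< a → a F.< b → Shape a b c
    below   : a F.< b → a F.< c → Shape a b c
    above   : b F.< a → c F.< a → Shape a b c
    tie-b   : a ≡ b → a F.< c ⊎ c F.< a → Shape a b c
    tie-c   : a ≡ c → a F.< b ⊎ b F.< a → Shape a b c
    tie-all : a ≡ b → a ≡ c → Shape a b c

  shape : (a b c : Fin k) → Shape a b c
  shape a b c with FP.<-cmp a b | FP.<-cmp a c
  ... | tri< a<b _ _ | tri< a<c _ _ = below a<b a<c
  ... | tri< a<b _ _ | tri≈ _ a≡c _ = tie-c a≡c (inj₁ a<b)
  ... | tri< a<b _ _ | tri> _ _ c<a = inside₂ c<a a<b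
  ... | tri≈ _ a≡b _ | tri< a<c _ _ = tie-b a≡b (inj₁ a<c)
  ... | tri≈ _ a≡b _ | tri≈ _ a≡c _ = tie-all a≡b a≡c
  ... | tri≈ _ a≡b _ | tri> _ _ c<a = tie-b a≡b (inj₂ c<a)
  ... | tri> _ _ b<a | tri< a<c _ _ = inside₁ b<a a<c
  ... | tri> _ _ b<a | tri≈ _ a≡c _ = tie-c a≡c (inj₂ b<a)
  ... | tri> _ _ b<a | tri> _ _ c<a = above b<a c<a

  -- Probability that a random compatible bijection puts i between j and k:
  -- certain if φ i is strictly inside, impossible if it is strictly outside,
  -- 1/2 if it ties with exactly one end point (the tied pair is ordered
  -- uniformly), and 1/3 if all three values tie.
  satisfactionProbability : {a b c : Fin k} → Shape a b c → ℚ
  satisfactionProbability (inside₁ _ _) = 1ℚ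
  satisfactionProbability (inside₂ _ _) = 1ℚ
  satisfactionProbability (below _ _)   = 0ℚ
  satisfactionProbability (above _ _)   = 0ℚ
  satisfactionProbability (tie-b _ _)   = (+ 1) / 2
  satisfactionProbability (tie-c _ _)   = (+ 1) / 2
  satisfactionProbability (tie-all _ _) = (+ 1) / 3

-- w((i,{j,k}), φ) as a function of (φ i, φ j, φ k); see w-closed.
W : Fin 4 → Fin 4 → Fin 4 → ℚ
W a b c = satisfactionProbability (shape a b c) - (+ 1) / 3

module _ {A : Set} (f : A → Bool) where

  allB-elim : (xs : List A) → T (allB f xs) → ∀ {x} → x ∈ xs → T (f x)
  allB-elim (y ∷ ys) t (here refl) = proj₁ (Equivalence.to BP.T-∧ t)
  allB-elim (y ∷ ys) t (there x∈ys) = allB-elim ys (proj₂ (Equivalence.to BP.T-∧ t)) x∈ys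

  allB-intro : (xs : List A) → (∀ x → T (f x)) → T (allB f xs)
  allB-intro []       fx = tt
  allB-intro (y ∷ ys) fx = Equivalence.from BP.T-∧ (fx y , allB-intro ys fx)

allB-allFin : {n : ℕ} (f : Fin n → Bool) → T (allB f (allFin n)) → ∀ x → T (f x)
allB-allFin {n} f t x = allB-elim f (allFin n) t (MP.∈-allFin x)

module _ {n : ℕ} where

  Injective : Vec (Fin n) n → Set
  Injective α = ∀ u v → u ≢ v → lookup α u ≢ lookup α v

  Compatible : Vec (Fin 4) n → Vec (Fin n) n → Set
  Compatible φ α = ∀ u v → lookup φ u F.< lookup φ v → lookup α u F.< lookup α v

  admissible : Vec (Fin 4) n → Vec (Fin n) n → Bool
  admissible φ α = isBijection α ∧ isCompatible φ α

  isBijection-sound : (α : Vec (Fin n) n) → T (isBijection α) → Injective α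
  isBijection-sound α t u v u≢v =
    [ (λ u≡v → contradiction (toWitness u≡v) u≢v) , toWitnessFalse ]′
      (Equivalence.to (BP.T-∨ {⌊ u ≟ᶠ v ⌋})
        (allB-allFin (pairTest u) (allB-allFin (λ u → allB (pairTest u) (allFin n)) t u) v))
    where
    pairTest : Fin n → Fin n → Bool
    pairTest u v = ⌊ u ≟ᶠ v ⌋ ∨ not ⌊ lookup α u ≟ᶠ lookup α v ⌋

  isBijection-complete : (α : Vec (Fin n) n) → Injective α → T (isBijection α)
  isBijection-complete α inj = allB-intro _ (allFin n) λ u → allB-intro _ (allFin n) λ v →
    Equivalence.from BP.T-∨ (pair u v (u ≟ᶠ v))
    where
    pair : ∀ u v (u≟v : Dec (u ≡ v)) → T ⌊ u≟v ⌋ ⊎ T (not ⌊ lookup α u ≟ᶠ lookup α v ⌋)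
    pair u v (yes _)   = inj₁ tt
    pair u v (no u≢v) = inj₂ (fromWitnessFalse (inj u v u≢v))

  isCompatible-sound : (φ : Vec (Fin 4) n) (α : Vec (Fin n) n) → T (isCompatible φ α) → Compatible φ α
  isCompatible-sound φ α t u v φu<φv =
    [ (λ φu≮φv → contradiction φu<φv (toWitnessFalse φu≮φv)) , toWitness ]′
      (Equivalence.to (BP.T-∨ {not ⌊ lookup φ u <ᶠ? lookup φ v ⌋})
        (allB-allFin (pairTest u) (allB-allFin (λ u → allB (pairTest u) (allFin n)) t u) v))
    where
    pairTest : Fin n → Fin n → Bool
    pairTest u v = not ⌊ lookup φ u <ᶠ? lookup φ v ⌋ ∨ ⌊ lookup α u <ᶠ? lookup α v ⌋

  isCompatible-complete : (φ : Vec (Fin 4) n) (α : Vec (Fin n) n) → Compatible φ α → T (isCompatible φ α)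
  isCompatible-complete φ α comp = allB-intro _ (allFin n) λ u → allB-intro _ (allFin n) λ v →
    Equivalence.from BP.T-∨ (pair u v (lookup φ u <ᶠ? lookup φ v))
    where
    pair : ∀ u v (φu<?φv : Dec (lookup φ u F.< lookup φ v)) →
           T (not ⌊ φu<?φv ⌋) ⊎ T ⌊ lookup α u <ᶠ? lookup α v ⌋
    pair u v (yes φu<φv) = inj₂ (fromWitness (comp u v φu<φv))
    pair u v (no _)       = inj₁ tt

  admissible-sound : (φ : Vec (Fin 4) n) (α : Vec (Fin n) n) →
                     T (admissible φ α) → Injective α × Compatible φ α
  admissible-sound φ α adm = isBijection-sound α (proj₁ parts) , isCompatible-sound φ α (proj₂ parts)
    where
    parts : T (isBijection α) × T (isCompatible φ α)
    parts = Equivalence.to (BP.T-∧ {isBijection α}) adm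

  admissible-complete : (φ : Vec (Fin 4) n) (α : Vec (Fin n) n) →
                        Injective α → Compatible φ α → T (admissible φ α)
  admissible-complete φ α inj comp =
    Equivalence.from BP.T-∧ (isBijection-complete α inj , isCompatible-complete φ α comp)

  ∈-compatibleBijections : (φ : Vec (Fin 4) n) {α : Vec (Fin n) n} →
                           α ∈ compatibleBijections φ → Injective α × Compatible φ α
  ∈-compatibleBijections φ {α} α∈ =
    admissible-sound φ α (proj₂ (MP.∈-filter⁻ (λ β → T? (admissible φ β)) {xs = allVec n n} α∈))

count : {A : Set} {P : A → Set} → (∀ x → Dec (P x)) → List A → ℕ
count P? []       = 0
count P? (x ∷ xs) with P? x
... | yes _ = suc (count P? xs)
... | no _  = count P? xs

module _ {A : Set} {P R : A → Set} (P? : ∀ x → Dec (P x)) (R? : ∀ x → Dec (R x))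
         (P⇒R : ∀ {x} → P x → R x) where

  count-mono : (xs : List A) → count P? xs ℕ.≤ count R? xs
  count-mono []       = ℕ.z≤n
  count-mono (x ∷ xs) with P? x | R? x
  ... | yes _  | yes _  = ℕ.s≤s (count-mono xs)
  ... | yes px | no ¬rx = contradiction (P⇒R px) ¬rx
  ... | no _   | yes _  = ℕP.m≤n⇒m≤1+n (count-mono xs)
  ... | no _   | no _   = count-mono xs

  count-strict : (xs : List A) {y : A} → y ∈ xs → R y → ¬ P y → count P? xs ℕ.< count R? xs
  count-strict (x ∷ xs) (here refl) ry ¬py with P? x | R? x
  ... | yes py | _      = contradiction py ¬py
  ... | no _   | yes _  = ℕ.s≤s (count-mono xs)
  ... | no _   | no ¬ry = contradiction ry ¬ry
  count-strict (x ∷ xs) (there y∈xs) ry ¬py with P? x | R? x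
  ... | yes _  | yes _  = ℕ.s≤s (count-strict xs y∈xs ry ¬py)
  ... | yes px | no ¬rx = contradiction (P⇒R px) ¬rx
  ... | no _   | yes _  = ℕP.m≤n⇒m≤1+n (count-strict xs y∈xs ry ¬py)
  ... | no _   | no _   = count-strict xs y∈xs ry ¬py

count-all : {A : Set} (xs : List A) → count (λ _ → yes tt) xs ≡ length xs
count-all []       = refl
count-all (x ∷ xs) = cong suc (count-all xs)

-- Every φ admits a compatible bijection: rank the variables lexicographically
-- by (φ value, index).
module Canonical {n : ℕ} (φ : Vec (Fin 4) n) where

  _≺_ : Fin n → Fin n → Set
  u ≺ v = lookup φ u F.< lookup φ v ⊎ (lookup φ u ≡ lookup φ v × u F.< v)

  _≺?_ : ∀ u v → Dec (u ≺ v)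
  u ≺? v = (lookup φ u <ᶠ? lookup φ v) ⊎-dec ((lookup φ u ≟ᶠ lookup φ v) ×-dec (u <ᶠ? v))

  ≺-irrefl : ∀ u → ¬ u ≺ u
  ≺-irrefl u (inj₁ φu<φu)      = FP.<-irrefl refl φu<φu
  ≺-irrefl u (inj₂ (_ , u<u)) = FP.<-irrefl refl u<u

  ≺-trans : ∀ {u v w} → u ≺ v → v ≺ w → u ≺ w
  ≺-trans (inj₁ a) (inj₁ b)              = inj₁ (FP.<-trans a b)
  ≺-trans (inj₁ a) (inj₂ (e , _))        = inj₁ (subst (_ F.<_) e a)
  ≺-trans (inj₂ (e , _)) (inj₁ b)        = inj₁ (subst (F._< _) (sym e) b)
  ≺-trans (inj₂ (e , a)) (inj₂ (e′ , b)) = inj₂ (trans e e′ , FP.<-trans a b)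

  ≺-connex : ∀ u v → u ≢ v → u ≺ v ⊎ v ≺ u
  ≺-connex u v u≢v with FP.<-cmp (lookup φ u) (lookup φ v)
  ... | tri< a _ _ = inj₁ (inj₁ a)
  ... | tri> _ _ c = inj₂ (inj₁ c)
  ... | tri≈ _ e _ with FP.<-cmp u v
  ...   | tri< a _ _   = inj₁ (inj₂ (e , a))
  ...   | tri≈ _ u≡v _ = contradiction u≡v u≢v
  ...   | tri> _ _ c   = inj₂ (inj₂ (sym e , c))

  rank : Fin n → ℕ
  rank v = count (_≺? v) (allFin n)

  rank<n : ∀ v → rank v ℕ.< n
  rank<n v = subst (rank v ℕ.<_) (trans (count-all (allFin n)) (LP.length-tabulate id))
    (count-strict (_≺? v) (λ _ → yes tt) (λ _ → tt) (allFin n) (MP.∈-allFin v) tt (≺-irrefl v))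

  rank-mono : ∀ {u v} → u ≺ v → rank u ℕ.< rank v
  rank-mono {u} {v} u≺v =
    count-strict (_≺? u) (_≺? v) (λ w≺u → ≺-trans w≺u u≺v) (allFin n) (MP.∈-allFin u) u≺v (≺-irrefl u)

  canonical : Vec (Fin n) n
  canonical = tabulate (λ v → fromℕ< (rank<n v))

  canonical-mono : ∀ {u v} → u ≺ v → lookup canonical u F.< lookup canonical v
  canonical-mono {u} {v} u≺v = subst₂ ℕ._<_ (sym (toℕ-canonical u)) (sym (toℕ-canonical v)) (rank-mono u≺v)
    where
    toℕ-canonical : ∀ w → toℕ (lookup canonical w) ≡ rank w
    toℕ-canonical w = trans (cong toℕ (VP.lookup∘tabulate _ w)) (FP.toℕ-fromℕ< (rank<n w))

  canonical-admissible : T (admissible φ canonical)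
  canonical-admissible = admissible-complete φ canonical injective (λ u v φu<φv → canonical-mono (inj₁ φu<φv))
    where
    injective : Injective canonical
    injective u v u≢v eq with ≺-connex u v u≢v
    ... | inj₁ u≺v = FP.<-irrefl eq (canonical-mono u≺v)
    ... | inj₂ v≺u = FP.<-irrefl (sym eq) (canonical-mono v≺u)

T-ext : {x y : Bool} → (T x → T y) → (T y → T x) → x ≡ y
T-ext {false} {false} _ _ = refl
T-ext {false} {true}  _ y⇒x = ⊥-elim (y⇒x tt)
T-ext {true}  {false} x⇒y _ = ⊥-elim (x⇒y tt)
T-ext {true}  {true}  _ _ = refl

module Swap {n : ℕ} (i j : Fin n) (i≢j : i ≢ j) where

  τ : Fin n → Fin n
  τ = transpose i j

  τ-i : τ i ≡ j
  τ-i rewrite dec-true (i ≟ᶠ i) refl = refl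

  τ-j : τ j ≡ i
  τ-j rewrite dec-false (j ≟ᶠ i) (i≢j ∘ sym) | dec-true (j ≟ᶠ j) refl = refl

  τ-other : ∀ {u} → u ≢ i → u ≢ j → τ u ≡ u
  τ-other {u} u≢i u≢j rewrite dec-false (u ≟ᶠ i) u≢i | dec-false (u ≟ᶠ j) u≢j = refl

  data Position (u : Fin n) : Set where
    at-i  : u ≡ i → Position u
    at-j  : u ≡ j → Position u
    other : u ≢ i → u ≢ j → Position u

  position : ∀ u → Position u
  position u with u ≟ᶠ i | u ≟ᶠ j
  ... | yes u≡i | _       = at-i u≡i
  ... | no _    | yes u≡j = at-j u≡j
  ... | no u≢i  | no u≢j  = other u≢i u≢j

  τ-involutive : ∀ u → τ (τ u) ≡ u
  τ-involutive u with position u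
  ... | at-i refl     = trans (cong τ τ-i) τ-j
  ... | at-j refl     = trans (cong τ τ-j) τ-i
  ... | other u≢i u≢j = trans (cong τ (τ-other u≢i u≢j)) (τ-other u≢i u≢j)

  swap : {A : Set} → Vec A n → Vec A n
  swap α = tabulate (lookup α ∘ τ)

  lookup-swap : {A : Set} (α : Vec A n) (u : Fin n) → lookup (swap α) u ≡ lookup α (τ u)
  lookup-swap α = VP.lookup∘tabulate (lookup α ∘ τ)

  lookup-swap-i : {A : Set} (α : Vec A n) → lookup (swap α) i ≡ lookup α j
  lookup-swap-i α = trans (lookup-swap α i) (cong (lookup α) τ-i)

  lookup-swap-j : {A : Set} (α : Vec A n) → lookup (swap α) j ≡ lookup α i
  lookup-swap-j α = trans (lookup-swap α j) (cong (lookup α) τ-j)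

  lookup-swap-other : {A : Set} (α : Vec A n) {u : Fin n} → u ≢ i → u ≢ j → lookup (swap α) u ≡ lookup α u
  lookup-swap-other α u≢i u≢j = trans (lookup-swap α _) (cong (lookup α) (τ-other u≢i u≢j))

  swap-involutive : {A : Set} (α : Vec A n) → swap (swap α) ≡ α
  swap-involutive α = vec-ext _ α λ u →
    trans (lookup-swap (swap α) u) (trans (lookup-swap α (τ u)) (cong (lookup α) (τ-involutive u)))

  swap-update : {A : Set} (α : Vec A n) (a b : A) → swap ((α [ j ]≔ b) [ i ]≔ a) ≡ (α [ j ]≔ a) [ i ]≔ b
  swap-update α a b = vec-ext _ _ λ u → trans (lookup-swap β u) (entry u (position u))
    where
    β : Vec _ n
    β = (α [ j ]≔ b) [ i ]≔ a
    entry : ∀ u → Position u → lookup β (τ u) ≡ lookup ((α [ j ]≔ a) [ i ]≔ b) u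
    entry u (at-i refl) rewrite τ-i =
      trans (VP.lookup∘update′ (i≢j ∘ sym) (α [ j ]≔ b) a)
        (trans (VP.lookup∘update j α b) (sym (VP.lookup∘update i (α [ j ]≔ a) b)))
    entry u (at-j refl) rewrite τ-j =
      trans (VP.lookup∘update i (α [ j ]≔ b) a)
        (sym (trans (VP.lookup∘update′ (i≢j ∘ sym) (α [ j ]≔ a) b) (VP.lookup∘update j α a)))
    entry u (other u≢i u≢j) rewrite τ-other u≢i u≢j =
      trans (VP.lookup∘update′ u≢i (α [ j ]≔ b) a)
        (trans (VP.lookup∘update′ u≢j α b)
          (sym (trans (VP.lookup∘update′ u≢i (α [ j ]≔ a) b) (VP.lookup∘update′ u≢j α a))))

  -- Summing over all vectors is invariant under the swap: resample both
  -- positions and exchange the two inner sums.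
  sum-swap-invariant : (k : ℕ) (F : Vec (Fin k) n → ℚ) →
                       (∑[ α ← allVec k n ] F (swap α)) ≡ sumOver (allVec k n) F
  sum-swap-invariant zero    F rewrite allVec-empty i = refl
  sum-swap-invariant (suc k) F = cancel (cancel (begin
      K * (K * sumOver Φ (F ∘ swap))
    ≡⟨ sym (resample-both (F ∘ swap)) ⟩
      (∑[ α ← Φ ] ∑[ b ← allFin (suc k) ] ∑[ a ← allFin (suc k) ] F (swap ((α [ j ]≔ b) [ i ]≔ a)))
    ≡⟨ sum-cong Φ (λ α → sum-cong (allFin (suc k)) λ b → sum-cong (allFin (suc k)) λ a →
         cong F (swap-update α a b)) ⟩
      (∑[ α ← Φ ] ∑[ b ← allFin (suc k) ] ∑[ a ← allFin (suc k) ] F ((α [ j ]≔ a) [ i ]≔ b))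
    ≡⟨ sum-cong Φ (λ α → sum-swap (allFin (suc k)) (allFin (suc k)) (λ b a → F ((α [ j ]≔ a) [ i ]≔ b))) ⟩
      (∑[ α ← Φ ] ∑[ a ← allFin (suc k) ] ∑[ b ← allFin (suc k) ] F ((α [ j ]≔ a) [ i ]≔ b))
    ≡⟨ resample-both F ⟩
      K * (K * sumOver Φ F) ∎))
    where
    open ≡-Reasoning
    K : ℚ
    K = ℕtoℚ (suc k)
    Φ : List (Vec (Fin (suc k)) n)
    Φ = allVec (suc k) n
    cancel : ∀ {x y} → K * x ≡ K * y → x ≡ y
    cancel = *-cancelˡ-pos _ _ K (ℕtoℚ-pos k)
    resample-both : (G : Vec (Fin (suc k)) n → ℚ) →
      (∑[ α ← Φ ] ∑[ b ← allFin (suc k) ] ∑[ a ← allFin (suc k) ] G ((α [ j ]≔ b) [ i ]≔ a))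
        ≡ K * (K * sumOver Φ G)
    resample-both G = trans (integrate (suc k) n j (λ α → ∑[ a ← allFin (suc k) ] G (α [ i ]≔ a)))
                            (cong (K *_) (integrate (suc k) n i G))

  module _ (φ : Vec (Fin 4) n) (φi≡φj : lookup φ i ≡ lookup φ j) where

    φ∘τ : ∀ u → lookup φ (τ u) ≡ lookup φ u
    φ∘τ u with position u
    ... | at-i refl     rewrite τ-i = sym φi≡φj
    ... | at-j refl     rewrite τ-j = φi≡φj
    ... | other u≢i u≢j rewrite τ-other u≢i u≢j = refl

    private
      admissible-swap⇒ : ∀ α → T (admissible φ α) → T (admissible φ (swap α))
      admissible-swap⇒ α adm = admissible-complete φ (swap α) injective compatible
        where
        injective : Injective (swap α)
        injective u v u≢v eq = proj₁ (admissible-sound φ α adm) (τ u) (τ v)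
          (λ τu≡τv → u≢v (trans (sym (τ-involutive u)) (trans (cong τ τu≡τv) (τ-involutive v))))
          (trans (sym (lookup-swap α u)) (trans eq (lookup-swap α v)))
        compatible : Compatible φ (swap α)
        compatible u v φu<φv = subst₂ F._<_ (sym (lookup-swap α u)) (sym (lookup-swap α v))
          (proj₂ (admissible-sound φ α adm) (τ u) (τ v) (subst₂ F._<_ (sym (φ∘τ u)) (sym (φ∘τ v)) φu<φv))

    admissible-swap : ∀ α → admissible φ (swap α) ≡ admissible φ α
    admissible-swap α = T-ext
      (λ t → subst (T ∘ admissible φ) (swap-involutive α) (admissible-swap⇒ (swap α) t))
      (admissible-swap⇒ α)


-- The closed form of w.  For fixed φ the average of ν over the compatible
-- bijections is a total divided by their number; swaps of positions tied
-- under φ permute the compatible bijections, which evaluates the totals.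

module CompatibleTotals {n : ℕ} (φ : Vec (Fin 4) n) where

  bijections : List (Vec (Fin n) n)
  bijections = compatibleBijections φ

  total : (Vec (Fin n) n → ℚ) → ℚ
  total f = sumOver bijections f

  size : ℚ
  size = ℕtoℚ (length bijections)

  total-const : (f : Vec (Fin n) n → ℚ) (r : ℚ) → (∀ {α} → α ∈ bijections → f α ≡ r) → total f ≡ r * size
  total-const f r f≡r = trans (sum-cong-∈ bijections f≡r) (trans (sum-const bijections r) (QP.*-comm _ r))

  total-cong : {f g : Vec (Fin n) n → ℚ} → (∀ {α} → α ∈ bijections → f α ≡ g α) → total f ≡ total g
  total-cong = sum-cong-∈ bijections

  total-swap : (i j : Fin n) (i≢j : i ≢ j) → lookup φ i ≡ lookup φ j → (f : Vec (Fin n) n → ℚ) →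
               total (f ∘ Swap.swap i j i≢j) ≡ total f
  total-swap i j i≢j φi≡φj f = begin
      total (f ∘ swap)
    ≡⟨ sum-filter (admissible φ) (allVec n n) (f ∘ swap) ⟩
      (∑[ α ← allVec n n ] (if admissible φ α then f (swap α) else 0ℚ))
    ≡⟨ sum-cong (allVec n n) (λ α → cong (λ b → if b then f (swap α) else 0ℚ)
                                        (sym (admissible-swap φ φi≡φj α))) ⟩
      (∑[ α ← allVec n n ] restricted (swap α))
    ≡⟨ sum-swap-invariant n restricted ⟩
      sumOver (allVec n n) restricted
    ≡⟨ sym (sum-filter (admissible φ) (allVec n n) f) ⟩
      total f ∎
    where
    open ≡-Reasoning
    open Swap i j i≢j
    restricted : Vec (Fin n) n → ℚ
    restricted α = if admissible φ α then f α else 0ℚ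

  private
    total-+ : (f g : Vec (Fin n) n → ℚ) → total (λ α → f α + g α) ≡ total f + total g
    total-+ = sum-+ bijections

    total-1 : total (λ _ → 1ℚ) ≡ size
    total-1 = trans (total-const (λ _ → 1ℚ) 1ℚ (λ _ → refl)) (QP.*-identityˡ size)

  total-pair : (i j : Fin n) (i≢j : i ≢ j) → lookup φ i ≡ lookup φ j → (f : Vec (Fin n) n → ℚ) →
               (∀ {α} → α ∈ bijections → f α + f (Swap.swap i j i≢j α) ≡ 1ℚ) →
               total f ≡ ((+ 1) / 2) * size
  total-pair i j i≢j φi≡φj f complementary = begin
      total f
    ≡⟨ half-of-double (total f) ⟩
      ((+ 1) / 2) * (total f + total f)
    ≡⟨ cong (λ s → ((+ 1) / 2) * (total f + s)) (sym (total-swap i j i≢j φi≡φj f)) ⟩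
      ((+ 1) / 2) * (total f + total (f ∘ Swap.swap i j i≢j))
    ≡⟨ cong (((+ 1) / 2) *_) (sym (total-+ f (f ∘ Swap.swap i j i≢j))) ⟩
      ((+ 1) / 2) * total (λ α → f α + f (Swap.swap i j i≢j α))
    ≡⟨ cong (((+ 1) / 2) *_) (trans (total-cong complementary) total-1) ⟩
      ((+ 1) / 2) * size ∎
    where
    open ≡-Reasoning
    half-of-double : ∀ x → x ≡ ((+ 1) / 2) * (x + x)
    half-of-double = solve 1 (λ x → x := con ((+ 1) / 2) :* (x :+ x)) refl
      where open +-*-Solver

  total-triple : (i j k : Fin n) (i≢j : i ≢ j) (i≢k : i ≢ k) →
                 lookup φ i ≡ lookup φ j → lookup φ i ≡ lookup φ k → (f : Vec (Fin n) n → ℚ) →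
                 (∀ {α} → α ∈ bijections → f α + f (Swap.swap i j i≢j α) + f (Swap.swap i k i≢k α) ≡ 1ℚ) →
                 total f ≡ ((+ 1) / 3) * size
  total-triple i j k i≢j i≢k φi≡φj φi≡φk f exhaustive = begin
      total f
    ≡⟨ third-of-triple (total f) ⟩
      ((+ 1) / 3) * (total f + total f + total f)
    ≡⟨ cong (λ s → ((+ 1) / 3) * (total f + s + total f))
            (sym (total-swap i j i≢j φi≡φj f)) ⟩
      ((+ 1) / 3) * (total f + total (f ∘ σᵢⱼ) + total f)
    ≡⟨ cong (λ s → ((+ 1) / 3) * (total f + total (f ∘ σᵢⱼ) + s))
            (sym (total-swap i k i≢k φi≡φk f)) ⟩
      ((+ 1) / 3) * (total f + total (f ∘ σᵢⱼ) + total (f ∘ σᵢₖ))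
    ≡⟨ cong (((+ 1) / 3) *_)
            (sym (trans (total-+ _ (f ∘ σᵢₖ)) (cong (_+ total (f ∘ σᵢₖ)) (total-+ f (f ∘ σᵢⱼ))))) ⟩
      ((+ 1) / 3) * total (λ α → f α + f (σᵢⱼ α) + f (σᵢₖ α))
    ≡⟨ cong (((+ 1) / 3) *_) (trans (total-cong exhaustive) total-1) ⟩
      ((+ 1) / 3) * size ∎
    where
    open ≡-Reasoning
    σᵢⱼ σᵢₖ : Vec (Fin n) n → Vec (Fin n) n
    σᵢⱼ = Swap.swap i j i≢j
    σᵢₖ = Swap.swap i k i≢k
    third-of-triple : ∀ x → x ≡ ((+ 1) / 3) * (x + x + x)
    third-of-triple = solve 1 (λ x → x := con ((+ 1) / 3) :* (x :+ x :+ x)) refl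
      where open +-*-Solver

module ClosedForm {n : ℕ} (φ : Vec (Fin 4) n) where
  open CompatibleTotals φ

  private
    compatible : ∀ {α} → α ∈ bijections → Compatible φ α
    compatible α∈ = proj₂ (∈-compatibleBijections φ α∈)

    injective : ∀ {α} → α ∈ bijections → Injective α
    injective α∈ = proj₁ (∈-compatibleBijections φ α∈)

  total-tie : (i j k : Fin n) → i ≢ j → i ≢ k → j ≢ k → lookup φ i ≡ lookup φ j →
              lookup φ i F.< lookup φ k ⊎ lookup φ k F.< lookup φ i →
              total (λ α → ν α (i , j , k)) ≡ ((+ 1) / 2) * size
  total-tie i j k i≢j i≢k j≢k φi≡φj side = total-pair i j i≢j φi≡φj _ λ {α} α∈ →
    trans (cong (λ s → ind (between (lookup α i) (lookup α j) (lookup α k)) + ind s)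
                (cong₃ between (lookup-swap-i α) (lookup-swap-j α) (lookup-swap-other α (i≢k ∘ sym) (j≢k ∘ sym))))
          (between-tie (lookup α i) (lookup α j) (lookup α k) (injective α∈ i j i≢j) (same-side α∈ side))
    where
    open Swap i j i≢j
    same-side : ∀ {α} → α ∈ bijections → lookup φ i F.< lookup φ k ⊎ lookup φ k F.< lookup φ i →
                (lookup α i F.< lookup α k × lookup α j F.< lookup α k) ⊎
                (lookup α k F.< lookup α i × lookup α k F.< lookup α j)
    same-side α∈ (inj₁ φi<φk) = inj₁ (compatible α∈ i k φi<φk , compatible α∈ j k (subst (F._< _) φi≡φj φi<φk))
    same-side α∈ (inj₂ φk<φi) = inj₂ (compatible α∈ k i φk<φi , compatible α∈ k j (subst (_ F.<_) φi≡φj φk<φi))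

  satisfaction-total : (i j k : Fin n) → i ≢ j → i ≢ k → j ≢ k →
                       (s : Shape (lookup φ i) (lookup φ j) (lookup φ k)) →
                       total (λ α → ν α (i , j , k)) ≡ satisfactionProbability s * size
  satisfaction-total i j k i≢j i≢k j≢k (inside₁ φj<φi φi<φk) = total-const _ 1ℚ λ α∈ →
    cong ind (between-inside₁ (compatible α∈ j i φj<φi) (compatible α∈ i k φi<φk))
  satisfaction-total i j k i≢j i≢k j≢k (inside₂ φk<φi φi<φj) = total-const _ 1ℚ λ α∈ →
    cong ind (between-inside₂ (compatible α∈ k i φk<φi) (compatible α∈ i j φi<φj))
  satisfaction-total i j k i≢j i≢k j≢k (below φi<φj φi<φk) = total-const _ 0ℚ λ α∈ →
    cong ind (between-below (compatible α∈ i j φi<φj) (compatible α∈ i k φi<φk))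
  satisfaction-total i j k i≢j i≢k j≢k (above φj<φi φk<φi) = total-const _ 0ℚ λ α∈ →
    cong ind (between-above (compatible α∈ j i φj<φi) (compatible α∈ k i φk<φi))
  satisfaction-total i j k i≢j i≢k j≢k (tie-b φi≡φj side) = total-tie i j k i≢j i≢k j≢k φi≡φj side
  satisfaction-total i j k i≢j i≢k j≢k (tie-c φi≡φk side) =
    trans (total-cong (λ {α} _ → cong ind (between-sym (lookup α i) (lookup α j) (lookup α k))))
          (total-tie i k j i≢k i≢j (j≢k ∘ sym) φi≡φk side)
  satisfaction-total i j k i≢j i≢k j≢k (tie-all φi≡φj φi≡φk) =
    total-triple i j k i≢j i≢k φi≡φj φi≡φk _ λ {α} α∈ →
      trans (cong₂ (λ s t → ind (between (lookup α i) (lookup α j) (lookup α k)) + ind s + ind t)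
                   (cong₃ between (Swap.lookup-swap-i i j i≢j α) (Swap.lookup-swap-j i j i≢j α)
                                  (Swap.lookup-swap-other i j i≢j α (i≢k ∘ sym) (j≢k ∘ sym)))
                   (cong₃ between (Swap.lookup-swap-i i k i≢k α) (Swap.lookup-swap-other i k i≢k α (i≢j ∘ sym) j≢k)
                                  (Swap.lookup-swap-j i k i≢k α)))
            (between-three (lookup α i) (lookup α j) (lookup α k)
                           (injective α∈ i j i≢j) (injective α∈ i k i≢k) (injective α∈ j k j≢k))

  w-closed : (i j k : Fin n) → WellFormed (i , j , k) → w (i , j , k) φ ≡ W (lookup φ i) (lookup φ j) (lookup φ k)
  w-closed i j k (i≢j , i≢k , j≢k) = cong (_- (+ 1) / 3)
    (average-as-ratio bijections (λ α → ν α (i , j , k)) (satisfactionProbability s) canonical∈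
      (satisfaction-total i j k i≢j i≢k j≢k s))
    where
    s : Shape (lookup φ i) (lookup φ j) (lookup φ k)
    s = shape (lookup φ i) (lookup φ j) (lookup φ k)
    open Canonical φ using (canonical; canonical-admissible)
    canonical∈ : canonical ∈ bijections
    canonical∈ = MP.∈-filter⁺ (λ α → T? (admissible φ α)) (∈-allVec n n canonical) canonical-admissible

-- The tables.  Everything below about them is a finite computation.

F³ : Set
F³ = Fin 4 → Fin 4 → Fin 4 → ℚ

-- Top = (1 − E₁)(1 − E₂)(1 − E₃) W, where Eₓ averages out one argument: the
-- component of W orthogonal to all functions of at most two arguments,
-- listed explicitly (in units of 1/24).  The proof uses only that its sums
-- along each argument vanish and the correlations below.
Top : F³
Top a b c = lookup (lookup (lookup table a) b) c / 24
  where
  open Int using (-_)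
  table : Vec (Vec (Vec ℤ 4) 4) 4
  table =
      ((+ 0 ∷ + 5 ∷ - + 1 ∷ - + 4 ∷ []) ∷ (+ 5 ∷ + 2 ∷ - + 2 ∷ - + 5 ∷ []) ∷
       (- + 1 ∷ - + 2 ∷ + 2 ∷ + 1 ∷ []) ∷ (- + 4 ∷ - + 5 ∷ + 1 ∷ + 8 ∷ []) ∷ [])
    ∷ ((- + 10 ∷ - + 1 ∷ + 7 ∷ + 4 ∷ []) ∷ (- + 1 ∷ + 0 ∷ + 2 ∷ - + 1 ∷ []) ∷
       (+ 7 ∷ + 2 ∷ - + 4 ∷ - + 5 ∷ []) ∷ (+ 4 ∷ - + 1 ∷ - + 5 ∷ + 2 ∷ []) ∷ [])
    ∷ ((+ 2 ∷ - + 5 ∷ - + 1 ∷ + 4 ∷ []) ∷ (- + 5 ∷ - + 4 ∷ + 2 ∷ + 7 ∷ []) ∷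
       (- + 1 ∷ + 2 ∷ + 0 ∷ - + 1 ∷ []) ∷ (+ 4 ∷ + 7 ∷ - + 1 ∷ - + 10 ∷ []) ∷ [])
    ∷ ((+ 8 ∷ + 1 ∷ - + 5 ∷ - + 4 ∷ []) ∷ (+ 1 ∷ + 2 ∷ - + 2 ∷ - + 1 ∷ []) ∷
       (- + 5 ∷ - + 2 ∷ + 2 ∷ + 5 ∷ []) ∷ (- + 4 ∷ - + 1 ∷ + 5 ∷ + 0 ∷ []) ∷ [])
    ∷ []

Top-balanced₁ : ∀ b c → (∑[ a ← allFin 4 ] Top a b c) ≡ 0ℚ
Top-balanced₁ = toWitness {a? = FP.all? λ b → FP.all? λ c → (∑[ a ← allFin 4 ] Top a b c) QP.≟ 0ℚ} tt

Top-balanced₂ : ∀ a c → (∑[ b ← allFin 4 ] Top a b c) ≡ 0ℚ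
Top-balanced₂ = toWitness {a? = FP.all? λ a → FP.all? λ c → (∑[ b ← allFin 4 ] Top a b c) QP.≟ 0ℚ} tt

Top-balanced₃ : ∀ a b → (∑[ c ← allFin 4 ] Top a b c) ≡ 0ℚ
Top-balanced₃ = toWitness {a? = FP.all? λ a → FP.all? λ b → (∑[ c ← allFin 4 ] Top a b c) QP.≟ 0ℚ} tt

pick : {A : Set} → Fin 3 → A → A → A → A
pick 0F a b c = a
pick 1F a b c = b
pick 2F a b c = c

-- the factor contributed by C_p to the (p, q) term of (2X − Y)·Y, by w-closed
G : F³
G a b c = (+ 2) / 1 * W a b c - Top a b c

-- E[G(a,b,c) · Top(rearranged a,b,c)] for independent uniform a, b, c: the
-- normalised pair term of two constraints on the same variables whose second
-- lists them in the positions (s, t, u) of the first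
correlation : Fin 3 → Fin 3 → Fin 3 → ℚ
correlation s t u = sum³ (λ a b c → G a b c * Top (pick s a b c) (pick t a b c) (pick u a b c)) * ((+ 1) / 64)

-- the values of the correlation that matter; their sum is 11/768
selfCorrelation crossCorrelation : ℚ
selfCorrelation  = (+ 11) / 384
crossCorrelation = Q.- ((+ 11) / 768)

Distinct : Fin 3 → Fin 3 → Fin 3 → Set
Distinct s t u = s ≢ t × s ≢ u × t ≢ u

distinct? : ∀ s t u → Dec (Distinct s t u)
distinct? s t u = ¬? (s ≟ᶠ t) ×-dec ¬? (s ≟ᶠ u) ×-dec ¬? (t ≟ᶠ u)

correlation-diagonal : correlation 0F 1F 2F ≡ selfCorrelation
correlation-diagonal = refl

-- any two constraints on the same three variables (including the value
-- 11/384 for equal ones and −11/768 for different middle variables)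
correlation-bound : ∀ s t u → Distinct s t u → crossCorrelation ≤ correlation s t u
correlation-bound = toWitness
  {a? = FP.all? λ s → FP.all? λ t → FP.all? λ u → distinct? s t u →-dec (crossCorrelation QP.≤? correlation s t u)} tt

-- Pair terms.

numMaps : ℕ → ℚ
numMaps n = ℕtoℚ (length (allVec 4 n))

Topᶜ : {n : ℕ} → Constraint n → Vec (Fin 4) n → ℚ
Topᶜ (i , j , k) φ = Top (lookup φ i) (lookup φ j) (lookup φ k)

pairTerm : {n : ℕ} → Constraint n → Constraint n → ℚ
pairTerm {n} c d = ∑[ φ ← allVec 4 n ] (((+ 2) / 1 * w c φ - Topᶜ c φ) * Topᶜ d φ)

pairTerm-closed : {n : ℕ} (i j k : Fin n) (d : Constraint n) → WellFormed (i , j , k) →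
                  pairTerm (i , j , k) d ≡ (∑[ φ ← allVec 4 n ] (G (lookup φ i) (lookup φ j) (lookup φ k) * Topᶜ d φ))
pairTerm-closed i j k d wf = sum-cong (allVec 4 _) λ φ →
  cong (λ x → ((+ 2) / 1 * x - Topᶜ (i , j , k) φ) * Topᶜ d φ) (ClosedForm.w-closed φ i j k wf)

fresh-variable : {n : ℕ} (h B : F³) (i j k t y z : Fin n) →
                 t ≢ i → t ≢ j → t ≢ k → t ≢ y → t ≢ z → (∀ b c → (∑[ a ← allFin 4 ] B a b c) ≡ 0ℚ) →
                 (∑[ φ ← allVec 4 n ] (h (lookup φ i) (lookup φ j) (lookup φ k) *
                                       B (lookup φ t) (lookup φ y) (lookup φ z))) ≡ 0ℚ
fresh-variable {n} h B i j k t y z t≢i t≢j t≢k t≢y t≢z B-balanced = orthogonal 3 n t _ _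
  (λ φ a → cong₃ h (VP.lookup∘update′ (t≢i ∘ sym) φ a) (VP.lookup∘update′ (t≢j ∘ sym) φ a)
                   (VP.lookup∘update′ (t≢k ∘ sym) φ a))
  (λ φ → trans (sum-cong (allFin 4) (λ a → cong₃ B (VP.lookup∘update t φ a)
                                                  (VP.lookup∘update′ (t≢y ∘ sym) φ a) (VP.lookup∘update′ (t≢z ∘ sym) φ a)))
               (B-balanced (lookup φ y) (lookup φ z)))

lookup-pick : {A : Set} {n : ℕ} (φ : Vec A n) (s : Fin 3) (i j k : Fin n) →
              lookup φ (pick s i j k) ≡ pick s (lookup φ i) (lookup φ j) (lookup φ k)
lookup-pick φ 0F i j k = refl
lookup-pick φ 1F i j k = refl
lookup-pick φ 2F i j k = refl

pairTerm-aligned : {n : ℕ} (i j k : Fin n) → WellFormed (i , j , k) → (s t u : Fin 3) →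
                   pairTerm (i , j , k) (pick s i j k , pick t i j k , pick u i j k)
                     ≡ numMaps n * correlation s t u
pairTerm-aligned {n} i j k wf@(i≢j , i≢k , j≢k) s t u = begin
    pairTerm (i , j , k) (pick s i j k , pick t i j k , pick u i j k)
  ≡⟨ pairTerm-closed i j k _ wf ⟩
    (∑[ φ ← Φ ] (G (lookup φ i) (lookup φ j) (lookup φ k) * Topᶜ (pick s i j k , pick t i j k , pick u i j k) φ))
  ≡⟨ sum-cong Φ (λ φ → cong (G (lookup φ i) (lookup φ j) (lookup φ k) *_)
                            (cong₃ Top (lookup-pick φ s i j k) (lookup-pick φ t i j k) (lookup-pick φ u i j k))) ⟩
    (∑[ φ ← Φ ] g (lookup φ i) (lookup φ j) (lookup φ k))
  ≡⟨ scale _ _ (sum-three-coordinates 4 n i j k i≢j i≢k j≢k g) ⟩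
    ℕtoℚ (length Φ) * correlation s t u ∎
  where
  open ≡-Reasoning
  Φ : List (Vec (Fin 4) n)
  Φ = allVec 4 n
  g : F³
  g a b c = G a b c * Top (pick s a b c) (pick t a b c) (pick u a b c)
  scale : ∀ x y → ℕtoℚ 4 * (ℕtoℚ 4 * (ℕtoℚ 4 * x)) ≡ ℕtoℚ (length Φ) * y →
          x ≡ ℕtoℚ (length Φ) * (y * ((+ 1) / 64))
  scale x y eq = trans (divide x) (trans (cong ((+ 1) / 64 *_) eq) (rearrange (ℕtoℚ (length Φ)) y))
    where
    open +-*-Solver
    divide : ∀ x → x ≡ (+ 1) / 64 * (ℕtoℚ 4 * (ℕtoℚ 4 * (ℕtoℚ 4 * x)))
    divide = solve 1 (λ x → x := con ((+ 1) / 64) :* (con (ℕtoℚ 4) :* (con (ℕtoℚ 4) :* (con (ℕtoℚ 4) :* x)))) refl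
    rearrange : ∀ a b → (+ 1) / 64 * (a * b) ≡ a * (b * ((+ 1) / 64))
    rearrange = solve 2 (λ a b → con ((+ 1) / 64) :* (a :* b) := a :* (b :* con ((+ 1) / 64))) refl

Located : {n : ℕ} → Fin n → Constraint n → Set
Located x (i , j , k) = Σ (Fin 3) λ s → x ≡ pick s i j k

locate? : {n : ℕ} (x : Fin n) (c : Constraint n) → Dec (Located x c)
locate? x (i , j , k) = FP.any? λ s → x ≟ᶠ pick s i j k

pick-InVars : {n : ℕ} (s : Fin 3) (i j k : Fin n) → InVars (pick s i j k) (i , j , k)
pick-InVars 0F i j k = inj₁ (inj₁ refl)
pick-InVars 1F i j k = inj₁ (inj₂ refl)
pick-InVars 2F i j k = inj₂ refl

InVars-pick : {n : ℕ} {x i j k : Fin n} → InVars x (i , j , k) → Located x (i , j , k)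
InVars-pick (inj₁ (inj₁ x≡i)) = 0F , x≡i
InVars-pick (inj₁ (inj₂ x≡j)) = 1F , x≡j
InVars-pick (inj₂ x≡k)        = 2F , x≡k

not-located : {n : ℕ} {x i j k : Fin n} → ¬ Located x (i , j , k) → x ≢ i × x ≢ j × x ≢ k
not-located x∉c = (λ e → x∉c (0F , e)) , (λ e → x∉c (1F , e)) , (λ e → x∉c (2F , e))

pick-distinct : {n : ℕ} (i j k : Fin n) (s t u : Fin 3) →
                WellFormed (pick s i j k , pick t i j k , pick u i j k) → Distinct s t u
pick-distinct i j k s t u (s≢t , s≢u , t≢u) =
  (s≢t ∘ cong (λ r → pick r i j k)) , (s≢u ∘ cong (λ r → pick r i j k)) , (t≢u ∘ cong (λ r → pick r i j k))

cover : ∀ s t u → Distinct s t u → ∀ r → (r ≡ s ⊎ r ≡ t) ⊎ r ≡ u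
cover = toWitness {a? = FP.all? λ s → FP.all? λ t → FP.all? λ u →
  distinct? s t u →-dec FP.all? λ r → ((r ≟ᶠ s) ⊎-dec (r ≟ᶠ t)) ⊎-dec (r ≟ᶠ u)} tt

located-SameVars : {n : ℕ} (i j k : Fin n) (s t u : Fin 3) →
                   WellFormed (pick s i j k , pick t i j k , pick u i j k) →
                   SameVars (i , j , k) (pick s i j k , pick t i j k , pick u i j k)
located-SameVars i j k s t u wf = c⊆d , d⊆c
  where
  distinct : Distinct s t u
  distinct = pick-distinct i j k s t u wf
  c⊆d : ∀ x → InVars x (i , j , k) → InVars x (pick s i j k , pick t i j k , pick u i j k)
  c⊆d x x∈c with InVars-pick x∈c
  ... | r , refl with cover s t u distinct r
  ...   | inj₁ (inj₁ refl) = inj₁ (inj₁ refl)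
  ...   | inj₁ (inj₂ refl) = inj₁ (inj₂ refl)
  ...   | inj₂ refl        = inj₂ refl
  d⊆c : ∀ x → InVars x (pick s i j k , pick t i j k , pick u i j k) → InVars x (i , j , k)
  d⊆c x (inj₁ (inj₁ refl)) = pick-InVars s i j k
  d⊆c x (inj₁ (inj₂ refl)) = pick-InVars t i j k
  d⊆c x (inj₂ refl)        = pick-InVars u i j k

-- A fresh
-- variable of d is moved to the first argument of Top by permuting arguments.
pairTerm-classify : {n : ℕ} (c d : Constraint n) → WellFormed c → WellFormed d →
  pairTerm c d ≡ 0ℚ ⊎ (SameVars c d × numMaps n * crossCorrelation ≤ pairTerm c d)
pairTerm-classify {n} (i , j , k) (i′ , j′ , k′) wfc wfd@(i′≢j′ , i′≢k′ , j′≢k′)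
  with locate? i′ (i , j , k) | locate? j′ (i , j , k) | locate? k′ (i , j , k)
... | no i′∉c | _ | _ with i′≢i , i′≢j , i′≢k ← not-located i′∉c = inj₁
  (trans (pairTerm-closed i j k _ wfc)
         (fresh-variable G Top i j k i′ j′ k′ i′≢i i′≢j i′≢k i′≢j′ i′≢k′ Top-balanced₁))
... | _ | no j′∉c | _ with j′≢i , j′≢j , j′≢k ← not-located j′∉c = inj₁
  (trans (pairTerm-closed i j k _ wfc)
         (fresh-variable G (λ a b c → Top b a c) i j k j′ i′ k′
                         j′≢i j′≢j j′≢k (i′≢j′ ∘ sym) j′≢k′ Top-balanced₂))
... | _ | _ | no k′∉c with k′≢i , k′≢j , k′≢k ← not-located k′∉c = inj₁
  (trans (pairTerm-closed i j k _ wfc)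
         (fresh-variable G (λ a b c → Top b c a) i j k k′ i′ j′
                         k′≢i k′≢j k′≢k (i′≢k′ ∘ sym) (j′≢k′ ∘ sym) Top-balanced₃))
... | yes (s , refl) | yes (t , refl) | yes (u , refl) = inj₂ (located-SameVars i j k s t u wfd ,
  subst (numMaps n * crossCorrelation ≤_) (sym (pairTerm-aligned i j k wfc s t u))
    (QP.*-monoˡ-≤-nonNeg (numMaps n) {{Q.nonNegative (ℕtoℚ-nonneg (length (allVec 4 n)))}}
                         (correlation-bound s t u (pick-distinct i j k s t u wfd))))

pairTerm-self : {n : ℕ} (c : Constraint n) → WellFormed c →
                pairTerm c c ≡ numMaps n * selfCorrelation
pairTerm-self {n} (i , j , k) wf = trans (pairTerm-aligned i j k wf 0F 1F 2F)
                                     (cong (numMaps n *_) correlation-diagonal)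

-- Counting and the theorem.

-- Each row of the pair-term matrix is at least |Φ| · 11/768: the diagonal
-- term gives 11/384 and, with no complete triple, at most one other
-- constraint shares the variables of C_p, costing at least 11/768.
row-bound : {n m : ℕ} (C : Fin m → Constraint n) → (∀ p → WellFormed (C p)) → ¬ HasCompleteTriple C →
            (p : Fin m) → numMaps n * ((+ 11) / 768) ≤ (∑[ q ← allFin m ] pairTerm (C p) (C q))
row-bound {n} {m} C wf noCT p = begin
    N * ((+ 11) / 768)
  ≡⟨ QP.*-distribˡ-+ N selfCorrelation crossCorrelation ⟩
    N * selfCorrelation + N * crossCorrelation
  ≤⟨ QP.+-mono-≤ (QP.≤-reflexive (sym (pairTerm-self (C p) (wf p))))
                 (sum-one-exception m others _ SharesVars cross≤0 classify unique) ⟩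
    pairTerm (C p) (C p) + sumOver (allFin m) others
  ≡⟨ sym (sum-split m p (λ q → pairTerm (C p) (C q))) ⟩
    (∑[ q ← allFin m ] pairTerm (C p) (C q)) ∎
  where
  open QP.≤-Reasoning
  N : ℚ
  N = numMaps n
  others : Fin m → ℚ
  others q = if ⌊ q ≟ᶠ p ⌋ then 0ℚ else pairTerm (C p) (C q)
  SharesVars : Fin m → Set
  SharesVars q = q ≢ p × SameVars (C p) (C q)
  cross≤0 : N * crossCorrelation ≤ 0ℚ
  cross≤0 = QP.nonPositive⁻¹ _
    {{QP.nonNeg*nonPos⇒nonPos N {{Q.nonNegative (ℕtoℚ-nonneg (length (allVec 4 n)))}} crossCorrelation}}
  classify : ∀ q → 0ℚ ≤ others q ⊎ (SharesVars q × N * crossCorrelation ≤ others q)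
  classify q with q ≟ᶠ p
  ... | yes _   = inj₁ QP.≤-refl
  ... | no q≢p with pairTerm-classify (C p) (C q) (wf p) (wf q)
  ...   | inj₁ vanishes          = inj₁ (QP.≤-reflexive (sym vanishes))
  ...   | inj₂ (same , bounded) = inj₂ ((q≢p , same) , bounded)
  unique : ∀ q q′ → SharesVars q → SharesVars q′ → q ≡ q′
  unique q q′ (q≢p , same) (q′≢p , same′) with q ≟ᶠ q′
  ... | yes q≡q′ = q≡q′
  ... | no q≢q′  = contradiction (p , q , q′ , (q≢p ∘ sym , q′≢p ∘ sym , q≢q′) , same , same′) noCT

sumTop : {n m : ℕ} → (Fin m → Constraint n) → Vec (Fin 4) n → ℚ
sumTop {m = m} C φ = ∑[ q ← allFin m ] Topᶜ (C q) φ

expand : {n m : ℕ} (C : Fin m → Constraint n) (φ : Vec (Fin 4) n) →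
         ((+ 2) / 1 * wSet C φ - sumTop C φ) * sumTop C φ
           ≡ (∑[ p ← allFin m ] ∑[ q ← allFin m ] (((+ 2) / 1 * w (C p) φ - Topᶜ (C p) φ) * Topᶜ (C q) φ))
expand {m = m} C φ = trans (cong (_* sumTop C φ) (sym linear))
  (sum-product (allFin m) (allFin m) (λ p → (+ 2) / 1 * w (C p) φ - Topᶜ (C p) φ) (λ q → Topᶜ (C q) φ))
  where
  linear : (∑[ p ← allFin m ] ((+ 2) / 1 * w (C p) φ - Topᶜ (C p) φ)) ≡ (+ 2) / 1 * wSet C φ - sumTop C φ
  linear = trans (sum-- (allFin m) _ _) (cong (_- sumTop C φ) (sum-*ˡ (allFin m) ((+ 2) / 1) (λ p → w (C p) φ)))

second-moment-sum : {n m : ℕ} (C : Fin m → Constraint n) → (∀ p → WellFormed (C p)) → ¬ HasCompleteTriple C →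
                    ℕtoℚ m * (numMaps n * ((+ 11) / 768))
                      ≤ (∑[ φ ← allVec 4 n ] (wSet C φ * wSet C φ))
second-moment-sum {n} {m} C wf noCT = begin
    ℕtoℚ m * (N * ((+ 11) / 768))
  ≡⟨ sym (sum-allFin-const m _) ⟩
    (∑[ p ← allFin m ] (N * ((+ 11) / 768)))
  ≤⟨ sum-mono (allFin m) (row-bound C wf noCT) ⟩
    (∑[ p ← allFin m ] ∑[ q ← allFin m ] pairTerm (C p) (C q))
  ≡⟨ sum-cong (allFin m) (λ p → sum-swap (allFin m) Φ (λ q φ → h p q φ)) ⟩
    (∑[ p ← allFin m ] ∑[ φ ← Φ ] ∑[ q ← allFin m ] h p q φ)
  ≡⟨ sum-swap (allFin m) Φ (λ p φ → sumOver (allFin m) (λ q → h p q φ)) ⟩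
    (∑[ φ ← Φ ] ∑[ p ← allFin m ] ∑[ q ← allFin m ] h p q φ)
  ≡⟨ sum-cong Φ (λ φ → sym (expand C φ)) ⟩
    (∑[ φ ← Φ ] (((+ 2) / 1 * wSet C φ - sumTop C φ) * sumTop C φ))
  ≤⟨ sum-mono Φ (λ φ → square-completion (wSet C φ) (sumTop C φ)) ⟩
    (∑[ φ ← Φ ] (wSet C φ * wSet C φ)) ∎
  where
  open QP.≤-Reasoning
  Φ : List (Vec (Fin 4) n)
  Φ = allVec 4 n
  N : ℚ
  N = numMaps n
  h : Fin m → Fin m → Vec (Fin 4) n → ℚ
  h p q φ = ((+ 2) / 1 * w (C p) φ - Topᶜ (C p) φ) * Topᶜ (C q) φ

lemma7 : (n m : ℕ) (C : Fin m → Constraint n) →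
         IsConstraintSet C → ¬ HasCompleteTriple C →
         ((+ 11) / 768) * ((+ m) / 1) ≤ expectedSquare C
lemma7 n m C (wf , _) noCT = QP.*-cancelʳ-≤-pos N {{Q.positive (length-pos Φ-inhabited)}} (begin
    ((+ 11) / 768) * ((+ m) / 1) * N   ≡⟨ cong (λ x → ((+ 11) / 768) * x * N) (sym (ℕtoℚ-fraction m)) ⟩
    ((+ 11) / 768) * ℕtoℚ m * N        ≡⟨ rearrange (ℕtoℚ m) N ⟩
    ℕtoℚ m * (N * ((+ 11) / 768))      ≤⟨ second-moment-sum C wf noCT ⟩
    (∑[ φ ← Φ ] (wSet C φ * wSet C φ))  ≡⟨ sym (avg-map Φ (λ φ → wSet C φ * wSet C φ) Φ-inhabited) ⟩
    expectedSquare C * N               ∎)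
  where
  open QP.≤-Reasoning
  Φ : List (Vec (Fin 4) n)
  Φ = allVec 4 n
  N : ℚ
  N = numMaps n
  Φ-inhabited : V.replicate n 0F ∈ Φ
  Φ-inhabited = ∈-allVec 4 n (V.replicate n 0F)
  rearrange : ∀ a b → ((+ 11) / 768) * a * b ≡ a * (b * ((+ 11) / 768))
  rearrange = solve 2 (λ a b → con ((+ 11) / 768) :* a :* b := a :* (b :* con ((+ 11) / 768))) refl
    where open +-*-Solver
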